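{- For all integers $n\geq 1$ and $m\geq 3$, $$\beta(K_n\,\square\,C_m)=\begin{cases}2, & \text{if } n=1,\\ 2, & \text{if } n=2 \text{ and } m \text{ is odd},\\ 3, & \text{if } n=2 \text{ and } m \text{ is even},\\ 3, & \text{if } n=3,\\ 3, & \text{if } n=4 \text{ and } m \text{ is even},\\ 4, & \text{if } n=4 \text{ and } m \text{ is odd},\\ n-1, & \text{if } n\geq 5.\end{cases}$$
   Context: $K_n$ is the complete graph on $n$ vertices and $C_m$ the cycle on $m$ vertices. $d(v,w)$ denotes shortest-path distance. A vertex $x$ resolves $v,w$ if $d(v,x)\neq d(w,x)$; a set resolves a graph if every pair of distinct vertices is resolved by some vertex of the set; $\beta(G)$ is the minimum size of a resolving set. The cartesian product $G\,\square\,H$ has vertex set $V(G)\times V(H)$, with $(a,v)\sim(b,w)$ iff ($a=b$ and $vw\in E(H)$) or ($v=w$ and $ab\in E(G)$). -}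

module Defs where

open import Data.Nat using (ℕ; zero; suc; _<_)
open import Data.Fin using (Fin; toℕ)
open import Data.Product using (Σ; _×_; _,_; ∃₂)
open import Data.Sum using (_⊎_)
open import Data.List using (List; length)
open import Data.List.Relation.Unary.Any using (Any)
open import Data.List.Relation.Unary.Unique.Propositional using (Unique)
open import Relation.Nullary using (¬_)
open import Relation.Binary.PropositionalEquality using (_≡_; _≢_)

record Graph : Set₁ where
  field
    V   : Set
    Adj : V → V → Set
open Graph public

data Walk (G : Graph) : V G → V G → ℕ → Set where
  here : ∀ {u} → Walk G u u zero
  step : ∀ {u v w k} → Adj G u v → Walk G v w k → Walk G u w (suc k)

Dist : (G : Graph) → V G → V G → ℕ → Set
Dist G u v k = Walk G u v k × (∀ j → j < k → ¬ Walk G u v j)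

Resolves : (G : Graph) → V G → V G → V G → Set
Resolves G x u w = ∃₂ λ k₁ k₂ → Dist G u x k₁ × Dist G w x k₂ × k₁ ≢ k₂

IsResolving : (G : Graph) → List (V G) → Set
IsResolving G S = ∀ u w → u ≢ w → Any (λ x → Resolves G x u w) S

MetricDim : Graph → ℕ → Set
MetricDim G b =
  Σ (List (V G)) (λ S → Unique S × length S ≡ b × IsResolving G S)
  × (∀ (S : List (V G)) → length S < b → ¬ IsResolving G S)

K : ℕ → Graph
K n = record { V = Fin n ; Adj = λ a b → a ≢ b }

-- Cycle C_m on Fin m: i ~ i+1 (mod m), symmetrically.
CycSucc : (m : ℕ) → Fin m → Fin m → Set
CycSucc m v w = (toℕ w ≡ suc (toℕ v)) ⊎ (suc (toℕ v) ≡ m × toℕ w ≡ 0)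

C : ℕ → Graph
C m = record { V = Fin m ; Adj = λ v w → CycSucc m v w ⊎ CycSucc m w v }

_□_ : Graph → Graph → Graph
G □ H = record
  { V = V G × V H
  ; Adj = λ { (a , v) (b , w) →
        (a ≡ b × Adj H v w) ⊎ (v ≡ w × Adj G a b) } }

{-# OPTIONS --safe #-}
module Submission where

-- Distances in K n □ C m split as d((a,k),(b,p)) = [a ≢ b] + d_C(k,p), with d_C the shorter arc
-- of the cycle.  Upper bounds come from explicit landmark sets: landmarks in every layer but one
-- reveal the layer of a vertex, two landmarks at one position in different layers reveal the exact
-- cycle distance to that position (the two indicator terms cannot both compensate), and the cycle
-- distances to two adjacent positions determine the position.  For n = 2 and m odd, landmarks at 0
-- and ⌊m/2⌋ in a single layer suffice; for n = 4 and m even, parity lets a single landmark at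
-- position 1 do the work of two.  Lower bounds exhibit, for every smaller landmark set, two vertices
-- at equal distance from all landmarks: equal positions in two landmark-free layers (so β ≥ n − 1),
-- the two cycle-neighbours of a common landmark position, a first step along a geodesic, the
-- antipode on an even cycle, or the edge opposite a landmark position on an odd cycle.

open import Defs
open import Data.Nat using (ℕ; _≤_; _%_)
open import Data.Nat using (_∸_)
open import Data.Product using (_×_)
open import Relation.Binary.PropositionalEquality using (_≡_)

open import Data.Nat using (zero; suc; _+_; _*_; _/_; _<_; _⊓_; ∣_-_∣; z≤n; s≤s; s≤s⁻¹; _≤?_; _<?_)
import Data.Nat as ℕ
open import Data.Nat.Properties
open import Data.Nat.DivMod using (m≡m%n+[m/n]*n)
open import Data.Nat.Tactic.RingSolver using (solve-∀)
open import Data.Fin using (Fin; toℕ; fromℕ; fromℕ<)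
import Data.Fin as Fin
open import Data.Fin.Properties using (toℕ-injective; toℕ-fromℕ; toℕ-fromℕ<; toℕ<n; pigeonhole; ¬∀⟶∃¬)
import Data.Fin.Properties as Finₚ
open import Data.Product using (Σ; ∃; ∃₂; _,_; proj₁; proj₂)
open import Data.Sum using (_⊎_; inj₁; inj₂)
open import Data.Empty using (⊥; ⊥-elim)
open import Data.List using (List; []; _∷_; length)
import Data.List as List
open import Data.List.Properties using (length-map; length-tabulate)
open import Data.List.Membership.Propositional using (_∈_; _∉_)
open import Data.List.Membership.Propositional.Properties using (∈-map⁺; ∈-allFin)
open import Data.List.Relation.Unary.All using (All; []; _∷_)
import Data.List.Relation.Unary.All as All
open import Data.List.Relation.Unary.All.Properties using (¬All⇒Any¬)
open import Data.List.Relation.Unary.AllPairs using ([]; _∷_)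
open import Data.List.Relation.Unary.Any using (Any; here; there)
import Data.List.Relation.Unary.Any as Any
open import Data.List.Relation.Unary.Any.Properties using (lookup-index)
open import Data.List.Relation.Unary.Unique.Propositional using (Unique)
import Data.List.Relation.Unary.Unique.Propositional.Properties as Unique
open import Function using (_∘_; id)
open import Relation.Nullary using (¬_; Dec; yes; no)
open import Relation.Binary.Definitions using (Tri; tri<; tri≈; tri>)
open import Relation.Binary.PropositionalEquality
  using (_≢_; refl; sym; trans; cong; cong₂; subst; subst₂; ≢-sym; module ≡-Reasoning)

-- Walks and distance formulas

module _ {G : Graph} where

  Walk-snoc : ∀ {u v w k} → Walk G u v k → Adj G v w → Walk G u w (suc k)
  Walk-snoc here        e = step e here
  Walk-snoc (step e' w) e = step e' (Walk-snoc w e)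

  Walk-reverse : (∀ {x y} → Adj G x y → Adj G y x) → ∀ {u v k} → Walk G u v k → Walk G v u k
  Walk-reverse sym-adj here       = here
  Walk-reverse sym-adj (step e w) = Walk-snoc (Walk-reverse sym-adj w) (sym-adj e)

  Walk-++ : ∀ {u v w j k} → Walk G u v j → Walk G v w k → Walk G u w (j + k)
  Walk-++ here       w₂ = w₂
  Walk-++ (step e w) w₂ = step e (Walk-++ w w₂)

  Walk-zero⇒≡ : ∀ {u v} → Walk G u v 0 → u ≡ v
  Walk-zero⇒≡ here = refl

  Dist-unique : ∀ {u v k k′} → Dist G u v k → Dist G u v k′ → k ≡ k′
  Dist-unique {k = k} {k′} (w , short) (w′ , short′) with <-cmp k k′
  ... | tri< k<k′ _ _ = ⊥-elim (short′ k k<k′ w)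
  ... | tri≈ _ k≡k′ _ = k≡k′
  ... | tri> _ _ k>k′ = ⊥-elim (short k′ k>k′ w′)

-- A candidate distance function is the graph distance as soon as it is realised by walks,
-- vanishes on the diagonal and drops by at most one along each edge.
record DistanceFormula (G : Graph) : Set where
  field
    δ      : V G → V G → ℕ
    δ-walk : ∀ u v → Walk G u v (δ u v)
    δ-self : ∀ u → δ u u ≡ 0
    δ-step : ∀ {u v} → Adj G u v → ∀ x → δ u x ≤ suc (δ v x)

module DistanceFormulaProperties {G : Graph} (D : DistanceFormula G) where
  open DistanceFormula D

  δ≤length : ∀ {u x j} → Walk G u x j → δ u x ≤ j
  δ≤length {u} here       = ≤-reflexive (δ-self u)
  δ≤length {x = x} (step e w) = ≤-trans (δ-step e x) (s≤s (δ≤length w))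

  dist : ∀ u x → Dist G u x (δ u x)
  dist u x = δ-walk u x , λ j j<δ w → <⇒≱ j<δ (δ≤length w)

  δ≡0⇒≡ : ∀ {u v} → δ u v ≡ 0 → u ≡ v
  δ≡0⇒≡ {u} {v} δ≡0 = Walk-zero⇒≡ (subst (Walk G u v) δ≡0 (δ-walk u v))

  δ-adjacent : ∀ {u v} → Adj G u v → δ u v ≤ 1
  δ-adjacent {v = v} e = ≤-trans (δ-step e v) (s≤s (≤-reflexive (δ-self v)))

  geodesic-step : ∀ {u v k} → δ u v ≡ suc k → ∃ λ w → Adj G u w × δ w v ≡ k
  geodesic-step {u} {v} {k} δ≡ = first-step (subst (Walk G u v) δ≡ (δ-walk u v))
    where
      first-step : Walk G u v (suc k) → ∃ λ w → Adj G u w × δ w v ≡ k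
      first-step (step {v = w} e rest) = w , e ,
        ≤-antisym (δ≤length rest) (s≤s⁻¹ (≤-trans (≤-reflexive (sym δ≡)) (δ-step e v)))

  δ≡1⇒adjacent : ∀ {u v} → δ u v ≡ 1 → Adj G u v
  δ≡1⇒adjacent δ≡1 with geodesic-step δ≡1
  ... | w , e , δ≡0 with δ≡0⇒≡ δ≡0
  ... | refl = e

  resolves⇒δ≢ : ∀ {x u w} → Resolves G x u w → δ u x ≢ δ w x
  resolves⇒δ≢ {x} {u} {w} (k₁ , k₂ , d₁ , d₂ , k₁≢k₂) δ≡ =
    k₁≢k₂ (trans (Dist-unique d₁ (dist u x)) (trans δ≡ (Dist-unique (dist w x) d₂)))

  δ≢⇒resolves : ∀ {x u w} → δ u x ≢ δ w x → Resolves G x u w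
  δ≢⇒resolves {x} {u} {w} δ≢ = δ u x , δ w x , dist u x , dist w x , δ≢

  record Equidistant (u w : V G) (S : List (V G)) : Set where
    constructor equidistant
    field distances : All (λ x → δ u x ≡ δ w x) S

  equidistant-at : ∀ {u w S x} → Equidistant u w S → x ∈ S → δ u x ≡ δ w x
  equidistant-at (equidistant es) = All.lookup es

  equidistant-sym : ∀ {u w S} → Equidistant u w S → Equidistant w u S
  equidistant-sym (equidistant es) = equidistant (All.map sym es)

  Twins : List (V G) → Set
  Twins S = ∃₂ λ u w → u ≢ w × Equidistant u w S

  twins⇒¬resolving : ∀ {S} → Twins S → ¬ IsResolving G S
  twins⇒¬resolving (u , w , u≢w , equidistant es) resolving = unresolved (resolving u w u≢w) es
    where
      unresolved : ∀ {S} → Any (λ x → Resolves G x u w) S → All (λ x → δ u x ≡ δ w x) S → ⊥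
      unresolved (here r)  (e ∷ _)  = resolves⇒δ≢ r e
      unresolved (there r) (_ ∷ es) = unresolved r es

  separating⇒resolving : ∀ S → (∀ u w → Equidistant u w S → u ≡ w) → IsResolving G S
  separating⇒resolving S separating u w u≢w =
    Any.map δ≢⇒resolves (¬All⇒Any¬ (λ x → δ u x ℕ.≟ δ w x) S (u≢w ∘ separating u w ∘ equidistant))

  twins-swap₁₂ : ∀ {x y S} → Twins (x ∷ y ∷ S) → Twins (y ∷ x ∷ S)
  twins-swap₁₂ (u , w , u≢w , equidistant (eˣ ∷ eʸ ∷ es)) = u , w , u≢w , equidistant (eʸ ∷ eˣ ∷ es)

  twins-swap₂₃ : ∀ {x y z S} → Twins (x ∷ y ∷ z ∷ S) → Twins (x ∷ z ∷ y ∷ S)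
  twins-swap₂₃ (u , w , u≢w , equidistant (eˣ ∷ eʸ ∷ eᶻ ∷ es)) = u , w , u≢w , equidistant (eˣ ∷ eᶻ ∷ eʸ ∷ es)

-- The distance in K n □ H

[_≢_] : ∀ {n} → Fin n → Fin n → ℕ
[ a ≢ b ] with a Fin.≟ b
... | yes _ = 0
... | no  _ = 1

[≢]-refl : ∀ {n} (a : Fin n) → [ a ≢ a ] ≡ 0
[≢]-refl a with a Fin.≟ a
... | yes _   = refl
... | no  a≢a = ⊥-elim (a≢a refl)

[≢]-≢ : ∀ {n} {a b : Fin n} → a ≢ b → [ a ≢ b ] ≡ 1
[≢]-≢ {a = a} {b} a≢b with a Fin.≟ b
... | yes a≡b = ⊥-elim (a≢b a≡b)
... | no  _   = refl

[≢]≤1 : ∀ {n} (a b : Fin n) → [ a ≢ b ] ≤ 1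
[≢]≤1 a b with a Fin.≟ b
... | yes _ = z≤n
... | no  _ = s≤s z≤n

[≢]≡0⇒≡ : ∀ {n} {a b : Fin n} → [ a ≢ b ] ≡ 0 → a ≡ b
[≢]≡0⇒≡ {a = a} {b} eq with a Fin.≟ b
... | yes a≡b = a≡b
... | no  _   = ⊥-elim (1+n≢0 eq)

private
  ≤1-+-<⇒≡0 : ∀ {A B Y Y′} → A ≤ 1 → A + Y ≡ B + Y′ → Y < Y′ → B ≡ 0
  ≤1-+-<⇒≡0 {A} {B} {Y} {Y′} A≤1 e Y<Y′ =
    n≤0⇒n≡0 (+-cancelʳ-≤ Y′ B 0 (≤-trans (≤-reflexive (sym e)) (≤-trans (+-monoˡ-≤ Y A≤1) Y<Y′)))

[≢]-cancel : ∀ {n} {c c′ l₁ l₂ : Fin n} {X X′} → l₁ ≢ l₂ →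
  [ c ≢ l₁ ] + X ≡ [ c′ ≢ l₁ ] + X′ → [ c ≢ l₂ ] + X ≡ [ c′ ≢ l₂ ] + X′ → X ≡ X′
[≢]-cancel {c = c} {c′} {l₁} {l₂} {X} {X′} l₁≢l₂ e₁ e₂ with <-cmp X X′
... | tri≈ _ X≡X′ _ = X≡X′
... | tri< X<X′ _ _ = ⊥-elim (l₁≢l₂ (trans (sym ([≢]≡0⇒≡ (≤1-+-<⇒≡0 ([≢]≤1 c l₁) e₁ X<X′)))
                                          ([≢]≡0⇒≡ (≤1-+-<⇒≡0 ([≢]≤1 c l₂) e₂ X<X′))))
... | tri> _ _ X′<X = ⊥-elim (l₁≢l₂ (trans (sym ([≢]≡0⇒≡ (≤1-+-<⇒≡0 ([≢]≤1 c′ l₁) (sym e₁) X′<X)))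
                                          ([≢]≡0⇒≡ (≤1-+-<⇒≡0 ([≢]≤1 c′ l₂) (sym e₂) X′<X))))

distance-K□ : ∀ n {H} → DistanceFormula H → DistanceFormula (K n □ H)
distance-K□ n {H} D = record
  { δ      = λ { (a , k) (b , p) → [ a ≢ b ] + δ k p }
  ; δ-walk = walk
  ; δ-self = λ { (a , k) → cong₂ _+_ ([≢]-refl a) (δ-self k) }
  ; δ-step = δ□-step
  }
  where
    open DistanceFormula D

    inLayer : ∀ {b k p j} → Walk H k p j → Walk (K n □ H) (b , k) (b , p) j
    inLayer here       = here
    inLayer (step e w) = step (inj₁ (refl , e)) (inLayer w)

    walk : ∀ u x → Walk (K n □ H) u x ([ proj₁ u ≢ proj₁ x ] + δ (proj₂ u) (proj₂ x))
    walk (a , k) (b , p) with a Fin.≟ b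
    ... | yes refl = inLayer (δ-walk k p)
    ... | no  a≢b  = step (inj₂ (refl , a≢b)) (inLayer (δ-walk k p))

    δ□-step : ∀ {u v} → Adj (K n □ H) u v → ∀ x →
      [ proj₁ u ≢ proj₁ x ] + δ (proj₂ u) (proj₂ x) ≤ suc ([ proj₁ v ≢ proj₁ x ] + δ (proj₂ v) (proj₂ x))
    δ□-step {a , k} {_ , l} (inj₁ (refl , e)) (c , p) =
      ≤-trans (+-monoʳ-≤ [ a ≢ c ] (δ-step e p)) (≤-reflexive (+-suc [ a ≢ c ] (δ l p)))
    δ□-step {a , k} (inj₂ (refl , _)) (c , p) = +-monoˡ-≤ (δ k p) (≤-trans ([≢]≤1 a c) (s≤s z≤n))

-- Arithmetic of the cycle distance

m+n≡o⇒o∸m≡n : ∀ {x y z} → x + y ≡ z → z ∸ x ≡ y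
m+n≡o⇒o∸m≡n {x} {y} refl = m+n∸m≡n x y

m+o≡n⇒∣m-n∣≡o : ∀ {k p d} → k + d ≡ p → ∣ k - p ∣ ≡ d
m+o≡n⇒∣m-n∣≡o {k} {d = d} refl = ∣m-m+n∣≡n k d

m+o≡n⇒∣n-m∣≡o : ∀ {k p d} → k + d ≡ p → ∣ p - k ∣ ≡ d
m+o≡n⇒∣n-m∣≡o {k} {p} k+d≡p = trans (∣-∣-comm p k) (m+o≡n⇒∣m-n∣≡o k+d≡p)

module CycleArithmetic (m : ℕ) where

  -- For 0 ≤ x ≤ m, the length of the shorter of the two arcs of C m joining points x apart.
  arc : ℕ → ℕ
  arc x = x ⊓ (m ∸ x)

  cdist : ℕ → ℕ → ℕ
  cdist k p = arc ∣ k - p ∣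

  arc-reflect : ∀ {x y} → x + y ≡ m → arc x ≡ arc y
  arc-reflect {x} {y} x+y≡m = begin
    x ⊓ (m ∸ x) ≡⟨ cong (x ⊓_) (m+n≡o⇒o∸m≡n x+y≡m) ⟩
    x ⊓ y       ≡⟨ ⊓-comm x y ⟩
    y ⊓ x       ≡⟨ cong (y ⊓_) (sym (m+n≡o⇒o∸m≡n (trans (+-comm y x) x+y≡m))) ⟩
    y ⊓ (m ∸ y) ∎
    where open ≡-Reasoning

  arc-short : ∀ {x} → x + x ≤ m → arc x ≡ x
  arc-short {x} x+x≤m = m≤n⇒m⊓n≡m (m+n≤o⇒m≤o∸n x x+x≤m)

  arc-long : ∀ {x y} → x + y ≡ m → y + y ≤ m → arc x ≡ y
  arc-long x+y≡m y+y≤m = trans (arc-reflect x+y≡m) (arc-short y+y≤m)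

  arc-suc : ∀ x → arc (suc x) ≤ suc (arc x)
  arc-suc x = ⊓-mono-≤ (≤-refl {suc x}) (≤-trans (∸-monoʳ-≤ m (n≤1+n x)) (n≤1+n (m ∸ x)))

  arc-pred : ∀ x → suc x ≤ m → arc x ≤ suc (arc (suc x))
  arc-pred x x<m = begin
    x ⊓ (m ∸ x)         ≡⟨ cong (x ⊓_) (+-∸-assoc 1 x<m) ⟩
    x ⊓ suc (m ∸ suc x) ≤⟨ ⊓-mono-≤ (m≤n+m x 2) (≤-refl {suc (m ∸ suc x)}) ⟩
    suc (arc (suc x))   ∎
    where open ≤-Reasoning

  arc-injective : ∀ {x y} → x ≤ m → y ≤ m → arc x ≡ arc y → x ≡ y ⊎ x + y ≡ m
  arc-injective {x} {y} x≤m y≤m eq with ⊓-sel x (m ∸ x) | ⊓-sel y (m ∸ y)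
  ... | inj₁ p | inj₁ q = inj₁ (trans (sym p) (trans eq q))
  ... | inj₁ p | inj₂ q = inj₂ (trans (cong (_+ y) (trans (sym p) (trans eq q))) (m∸n+n≡m y≤m))
  ... | inj₂ p | inj₁ q = inj₂ (trans (cong (x +_) (trans (sym q) (trans (sym eq) p))) (m+[n∸m]≡n x≤m))
  ... | inj₂ p | inj₂ q = inj₁ (∸-cancelˡ-≡ x≤m y≤m (trans (sym p) (trans eq q)))

  arc-≤-half : ∀ {h} → m ≡ h + h → ∀ x → arc x ≤ h
  arc-≤-half {h} m≡h+h x with x ≤? h
  ... | yes x≤h = ≤-trans (m⊓n≤m x (m ∸ x)) x≤h
  ... | no  x≰h = ≤-trans (m⊓n≤n x (m ∸ x)) (begin
    m ∸ x ≤⟨ ∸-monoʳ-≤ m (<⇒≤ (≰⇒> x≰h)) ⟩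
    m ∸ h ≡⟨ cong (_∸ h) m≡h+h ⟩
    h + h ∸ h ≡⟨ m+n∸n≡m h h ⟩
    h ∎)
    where open ≤-Reasoning

  cdist-self : ∀ k → cdist k k ≡ 0
  cdist-self k = cong arc (∣n-n∣≡0 k)

  cdist-comm : ∀ k p → cdist k p ≡ cdist p k
  cdist-comm k p = cong arc (∣-∣-comm k p)

  cdist-zero : ∀ k → cdist k 0 ≡ arc k
  cdist-zero k = cong arc (∣-∣-identityʳ k)

  cdist-short : ∀ {a b d} → a + d ≡ b → d + d ≤ m → cdist a b ≡ d × cdist b a ≡ d
  cdist-short a+d≡b d+d≤m =
    trans (cong arc (m+o≡n⇒∣m-n∣≡o a+d≡b)) (arc-short d+d≤m) ,
    trans (cong arc (m+o≡n⇒∣n-m∣≡o a+d≡b)) (arc-short d+d≤m)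

  cdist-long : ∀ {a b d e} → a + d ≡ b → d + e ≡ m → e + e ≤ m → cdist a b ≡ e × cdist b a ≡ e
  cdist-long a+d≡b d+e≡m e+e≤m =
    trans (cong arc (m+o≡n⇒∣m-n∣≡o a+d≡b)) (arc-long d+e≡m e+e≤m) ,
    trans (cong arc (m+o≡n⇒∣n-m∣≡o a+d≡b)) (arc-long d+e≡m e+e≤m)

  cdist-suc : ∀ k p → suc k < m → p < m → cdist (suc k) p ≤ suc (cdist k p) × cdist k p ≤ suc (cdist (suc k) p)
  cdist-suc k p 1+k<m p<m with p ≤? k
  ... | yes p≤k =
    let (d , p+d≡k) = m≤n⇒∃[o]m+o≡n p≤k
        d<m = ≤-trans (s≤s (≤-trans (m≤n+m d p) (≤-reflexive p+d≡k))) (<⇒≤ 1+k<m)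
    in subst₂ (λ X Y → arc Y ≤ suc (arc X) × arc X ≤ suc (arc Y))
         (sym (m+o≡n⇒∣n-m∣≡o p+d≡k)) (sym (m+o≡n⇒∣n-m∣≡o (trans (+-suc p d) (cong suc p+d≡k))))
         (arc-suc d , arc-pred d d<m)
  ... | no  p≰k =
    let (d , k+1+d≡p) = m≤n⇒∃[o]m+o≡n (≰⇒> p≰k)
        d<m = ≤-trans (s≤s (m≤n+m d k)) (≤-trans (≤-reflexive k+1+d≡p) (<⇒≤ p<m))
    in subst₂ (λ X Y → arc Y ≤ suc (arc X) × arc X ≤ suc (arc Y))
         (sym (m+o≡n⇒∣m-n∣≡o (trans (+-suc k d) k+1+d≡p))) (sym (m+o≡n⇒∣m-n∣≡o k+1+d≡p))
         (arc-pred d d<m , arc-suc d)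

  cdist-wrap : ∀ k p → suc k ≡ m → p < m → cdist k p ≤ suc (cdist 0 p) × cdist 0 p ≤ suc (cdist k p)
  cdist-wrap k p 1+k≡m p<m =
    let (d , p+d≡k) = m≤n⇒∃[o]m+o≡n (≤-pred (subst (p <_) (sym 1+k≡m) p<m))
        d+1+p≡m = trans (+-suc d p) (trans (cong suc (trans (+-comm d p) p+d≡k)) 1+k≡m)
        cdist-k-p = trans (cong arc (m+o≡n⇒∣n-m∣≡o p+d≡k)) (arc-reflect d+1+p≡m)
    in subst (λ X → X ≤ suc (arc p) × arc p ≤ suc X) (sym cdist-k-p) (arc-suc p , arc-pred p p<m)

  -- Position k lies t steps after position p: k ≡ p + t (mod m).
  Offset : ℕ → ℕ → ℕ → Set
  Offset p t k = (p + t ≡ k) ⊎ (p + t ≡ k + m)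

  offset-zero : ∀ p → Offset p 0 p
  offset-zero p = inj₁ (+-identityʳ p)

  private
    cdist-across-wrap : ∀ {p a b k l} → a < m → l < m → p + a ≡ k + m → p + b ≡ l → cdist k l ≡ cdist a b
    cdist-across-wrap {p} {a} {b} {k} {l} a<m l<m p+a≡k+m p+b≡l =
      trans (cong arc (m+o≡n⇒∣m-n∣≡o (sym l≡k+[m∸d])))
        (trans (arc-reflect (m∸n+n≡m d≤m)) (cong arc (sym (m+o≡n⇒∣n-m∣≡o b+d≡a))))
      where
        b<a : b < a
        b<a = +-cancelˡ-< p b a (subst (_< p + a) (sym p+b≡l)
                (subst (l <_) (sym p+a≡k+m) (≤-trans l<m (m≤n+m m k))))
        d = proj₁ (m≤n⇒∃[o]m+o≡n (<⇒≤ b<a))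
        b+d≡a = proj₂ (m≤n⇒∃[o]m+o≡n (<⇒≤ b<a))
        d≤m : d ≤ m
        d≤m = ≤-trans (m≤n+m d b) (≤-trans (≤-reflexive b+d≡a) (<⇒≤ a<m))
        l≡k+[m∸d] : l ≡ k + (m ∸ d)
        l≡k+[m∸d] = +-cancelʳ-≡ d l (k + (m ∸ d)) (begin
          l + d             ≡⟨ cong (_+ d) (sym p+b≡l) ⟩
          p + b + d         ≡⟨ +-assoc p b d ⟩
          p + (b + d)       ≡⟨ cong (p +_) b+d≡a ⟩
          p + a             ≡⟨ p+a≡k+m ⟩
          k + m             ≡⟨ cong (k +_) (sym (m∸n+n≡m d≤m)) ⟩
          k + (m ∸ d + d)   ≡⟨ sym (+-assoc k (m ∸ d) d) ⟩
          k + (m ∸ d) + d   ∎)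
          where open ≡-Reasoning

  cdist-offset : ∀ {p a b k l} → a < m → b < m → k < m → l < m →
    Offset p a k → Offset p b l → cdist k l ≡ cdist a b
  cdist-offset {p} {a} {b} _ _ _ _ (inj₁ refl) (inj₁ refl) = cong arc (∣m+n-m+o∣≡∣n-o∣ p a b)
  cdist-offset {p} {a} {b} {k} {l} _ _ _ _ (inj₂ p+a≡k+m) (inj₂ p+b≡l+m) = cong arc (begin
    ∣ k - l ∣         ≡⟨ sym (∣m+n-m+o∣≡∣n-o∣ m k l) ⟩
    ∣ m + k - m + l ∣ ≡⟨ cong₂ ∣_-_∣ (trans (+-comm m k) (sym p+a≡k+m)) (trans (+-comm m l) (sym p+b≡l+m)) ⟩
    ∣ p + a - p + b ∣ ≡⟨ ∣m+n-m+o∣≡∣n-o∣ p a b ⟩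
    ∣ a - b ∣         ∎)
    where open ≡-Reasoning
  cdist-offset a<m _ _ l<m (inj₂ p+a≡k+m) (inj₁ p+b≡l) = cdist-across-wrap a<m l<m p+a≡k+m p+b≡l
  cdist-offset {a = a} {b} {k} {l} _ b<m k<m _ (inj₁ p+a≡k) (inj₂ p+b≡l+m) =
    trans (cdist-comm k l) (trans (cdist-across-wrap b<m k<m p+b≡l+m p+a≡k) (cdist-comm b a))

  offset-injective : ∀ {p a b k} → a < m → b < m → Offset p a k → Offset p b k → a ≡ b
  offset-injective {p} _ _ (inj₁ e₁) (inj₁ e₂) = +-cancelˡ-≡ p _ _ (trans e₁ (sym e₂))
  offset-injective {p} _ _ (inj₂ e₁) (inj₂ e₂) = +-cancelˡ-≡ p _ _ (trans e₁ (sym e₂))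
  offset-injective {p} {a} _ b<m (inj₁ e₁) (inj₂ e₂) = ⊥-elim (<⇒≱ b<m (≤-trans (m≤n+m m a)
    (≤-reflexive (+-cancelˡ-≡ p _ _ (trans (sym (+-assoc p a m)) (trans (cong (_+ m) e₁) (sym e₂)))))))
  offset-injective {p} {a} {b} a<m _ (inj₂ e₁) (inj₁ e₂) = ⊥-elim (<⇒≱ a<m (≤-trans (m≤n+m m b)
    (≤-reflexive (+-cancelˡ-≡ p _ _ (trans (sym (+-assoc p b m)) (trans (cong (_+ m) e₂) (sym e₁)))))))

  offset-functional : ∀ {p t k k′} → k < m → k′ < m → Offset p t k → Offset p t k′ → k ≡ k′
  offset-functional _ _ (inj₁ e₁) (inj₁ e₂) = trans (sym e₁) e₂
  offset-functional _ _ (inj₂ e₁) (inj₂ e₂) = +-cancelʳ-≡ m _ _ (trans (sym e₁) e₂)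
  offset-functional {k′ = k′} k<m _ (inj₁ e₁) (inj₂ e₂) =
    ⊥-elim (<⇒≱ k<m (≤-trans (m≤n+m m k′) (≤-reflexive (trans (sym e₂) e₁))))
  offset-functional {k = k} _ k′<m (inj₂ e₁) (inj₁ e₂) =
    ⊥-elim (<⇒≱ k′<m (≤-trans (m≤n+m m k) (≤-reflexive (trans (sym e₁) e₂))))

  offset-target : ∀ {p t} → p < m → t < m → ∃ λ k → k < m × Offset p t k
  offset-target {p} {t} p<m t<m with p + t <? m
  ... | yes p+t<m = p + t , p+t<m , inj₁ refl
  ... | no  p+t≮m = p + t ∸ m ,
    subst (p + t ∸ m <_) (m+n∸m≡n m m) (∸-monoˡ-< (+-mono-< p<m t<m) (≮⇒≥ p+t≮m)) ,
    inj₂ (sym (m∸n+n≡m (≮⇒≥ p+t≮m)))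

  offset-source : ∀ {p k} → p < m → k < m → ∃ λ t → t < m × Offset p t k × (t ≡ 0 → k ≡ p)
  offset-source {p} {k} p<m k<m with p ≤? k
  ... | yes p≤k =
    let (d , p+d≡k) = m≤n⇒∃[o]m+o≡n p≤k
    in d , ≤-<-trans (≤-trans (m≤n+m d p) (≤-reflexive p+d≡k)) k<m , inj₁ p+d≡k ,
       λ d≡0 → trans (sym p+d≡k) (trans (cong (p +_) d≡0) (+-identityʳ p))
  ... | no  p≰k = (m ∸ p) + k , subst (m ∸ p + k <_) (m∸n+n≡m (<⇒≤ p<m)) (+-monoʳ-< (m ∸ p) (≰⇒> p≰k)) ,
    inj₂ (trans (sym (+-assoc p (m ∸ p) k)) (trans (cong (_+ k) (m+[n∸m]≡n (<⇒≤ p<m))) (+-comm m k))) ,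
    λ e → ⊥-elim (<⇒≱ p<m (m∸n≡0⇒m≤n (n≤0⇒n≡0 (m+n≤o⇒m≤o (m ∸ p) {k} (≤-reflexive e)))))

  offset-reverse : ∀ {p s q} → s ≤ m → Offset p s q → Offset q (m ∸ s) p
  offset-reverse {p} {s} {q} s≤m (inj₁ p+s≡q) = inj₂ (begin
    q + (m ∸ s)     ≡⟨ cong (_+ (m ∸ s)) (sym p+s≡q) ⟩
    p + s + (m ∸ s) ≡⟨ +-assoc p s (m ∸ s) ⟩
    p + (s + (m ∸ s)) ≡⟨ cong (p +_) (m+[n∸m]≡n s≤m) ⟩
    p + m           ∎)
    where open ≡-Reasoning
  offset-reverse {p} {s} {q} s≤m (inj₂ p+s≡q+m) = inj₁ (+-cancelʳ-≡ s _ _ (begin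
    q + (m ∸ s) + s   ≡⟨ +-assoc q (m ∸ s) s ⟩
    q + (m ∸ s + s)   ≡⟨ cong (q +_) (m∸n+n≡m s≤m) ⟩
    q + m             ≡⟨ sym p+s≡q+m ⟩
    p + s             ∎))
    where open ≡-Reasoning

  private
    offset-wrapped : ∀ {p a q b} → p + a ≡ q + m → p + (a + b) ≡ q + b + m
    offset-wrapped {p} {a} {q} {b} p+a≡q+m = begin
      p + (a + b)   ≡⟨ sym (+-assoc p a b) ⟩
      p + a + b     ≡⟨ cong (_+ b) p+a≡q+m ⟩
      q + m + b     ≡⟨ +-assoc q m b ⟩
      q + (m + b)   ≡⟨ cong (q +_) (+-comm m b) ⟩
      q + (b + m)   ≡⟨ sym (+-assoc q b m) ⟩
      q + b + m     ∎
      where open ≡-Reasoning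

    offset-compose : ∀ {p a q b r} → Offset p a q → Offset q b r →
      p + (a + b) ≡ r ⊎ p + (a + b) ≡ r + m ⊎ p + (a + b) ≡ r + m + m
    offset-compose {p} {a} {q} {b} (inj₁ p+a≡q) (inj₁ q+b≡r) =
      inj₁ (trans (sym (+-assoc p a b)) (trans (cong (_+ b) p+a≡q) q+b≡r))
    offset-compose {p} {a} {q} {b} (inj₁ p+a≡q) (inj₂ q+b≡r+m) =
      inj₂ (inj₁ (trans (sym (+-assoc p a b)) (trans (cong (_+ b) p+a≡q) q+b≡r+m)))
    offset-compose {p} {a} {q} {b} (inj₂ p+a≡q+m) (inj₁ q+b≡r) =
      inj₂ (inj₁ (trans (offset-wrapped {p} {a} {q} {b} p+a≡q+m) (cong (_+ m) q+b≡r)))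
    offset-compose {p} {a} {q} {b} (inj₂ p+a≡q+m) (inj₂ q+b≡r+m) =
      inj₂ (inj₂ (trans (offset-wrapped {p} {a} {q} {b} p+a≡q+m) (cong (_+ m) q+b≡r+m)))

  offset-+ : ∀ {p a q b r} → p < m → a + b < m → Offset p a q → Offset q b r → Offset p (a + b) r
  offset-+ {p} {a} {q} {b} {r} p<m a+b<m o₁ o₂ with offset-compose {p} {a} {q} {b} {r} o₁ o₂
  ... | inj₁ e        = inj₁ e
  ... | inj₂ (inj₁ e) = inj₂ e
  ... | inj₂ (inj₂ e) = ⊥-elim (<⇒≱ (+-mono-< p<m a+b<m)
          (≤-trans (m≤n+m (m + m) r) (≤-reflexive (trans (sym (+-assoc r m m)) (sym e)))))

  offset-+-wrap : ∀ {p a q b r c} → r < m → a + b ≡ c + m → Offset p a q → Offset q b r → Offset p c r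
  offset-+-wrap {p} {a} {q} {b} {r} {c} r<m a+b≡c+m o₁ o₂ = reduce (offset-compose {p} {a} {q} {b} {r} o₁ o₂)
    where
      p+c+m≡ : p + c + m ≡ p + (a + b)
      p+c+m≡ = trans (+-assoc p c m) (cong (p +_) (sym a+b≡c+m))

      reduce : p + (a + b) ≡ r ⊎ p + (a + b) ≡ r + m ⊎ p + (a + b) ≡ r + m + m → Offset p c r
      reduce (inj₁ e)        = ⊥-elim (<⇒≱ r<m (≤-trans (m≤n+m m (p + c)) (≤-reflexive (trans p+c+m≡ e))))
      reduce (inj₂ (inj₁ e)) = inj₁ (+-cancelʳ-≡ m _ _ (trans p+c+m≡ e))
      reduce (inj₂ (inj₂ e)) = inj₂ (+-cancelʳ-≡ m _ _ (trans p+c+m≡ e))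

  cdist-0-1-injective : ∀ {k k′} → k < m → k′ < m → cdist k 0 ≡ cdist k′ 0 → cdist k 1 ≡ cdist k′ 1 → k ≡ k′
  cdist-0-1-injective {k} {k′} k<m k′<m e₀ e₁
    with arc-injective (<⇒≤ k<m) (<⇒≤ k′<m) (trans (sym (cdist-zero k)) (trans e₀ (cdist-zero k′)))
  ... | inj₁ k≡k′ = k≡k′
  cdist-0-1-injective {zero}  {k′}    _   k′<m _ _ | inj₂ k+k′≡m = ⊥-elim (<-irrefl k+k′≡m k′<m)
  cdist-0-1-injective {suc a} {zero}  k<m _    _ _ | inj₂ k+0≡m  = ⊥-elim (<-irrefl (trans (sym (+-identityʳ (suc a))) k+0≡m) k<m)
  cdist-0-1-injective {suc a} {suc b} k<m k′<m _ e₁ | inj₂ k+k′≡m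
    with arc-injective (≤-trans (n≤1+n a) (<⇒≤ k<m)) (≤-trans (n≤1+n b) (<⇒≤ k′<m))
           (trans (sym (cdist-zero a)) (trans e₁ (cdist-zero b)))
  ... | inj₁ a≡b   = cong suc a≡b
  ... | inj₂ a+b≡m = ⊥-elim (m≢1+n+m (a + b) {1} (trans a+b≡m (trans (sym k+k′≡m) (cong suc (+-suc a b)))))

  cdist-1-parity : ∀ {h k} → m ≡ h + h → 2 < m → k < m → cdist k 1 ≡ suc (cdist k 0) ⊎ cdist k 0 ≡ suc (cdist k 1)
  cdist-1-parity {h} {zero} m≡h+h 2<m _ = inj₁ (arc-short (<⇒≤ 2<m))
  cdist-1-parity {h} {suc a} m≡h+h 2<m k<m with suc a + suc a ≤? m
  ... | yes 2k≤m = inj₂ (trans (cdist-zero (suc a)) (trans (arc-short 2k≤m)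
                     (cong suc (sym (trans (cdist-zero a) (arc-short (≤-trans (+-mono-≤ (n≤1+n a) (n≤1+n a)) 2k≤m)))))))
  ... | no  2k≰m = inj₁ (trans (cdist-zero a) (trans (arc-long a+1+e≡m (half≤ 1+e≤h))
                     (cong suc (sym (trans (cdist-zero (suc a)) (arc-long 1+a+e≡m (half≤ (≤-trans (n≤1+n e) 1+e≤h))))))))
    where
      half≤ : ∀ {x} → x ≤ h → x + x ≤ m
      half≤ x≤h = ≤-trans (+-mono-≤ x≤h x≤h) (≤-reflexive (sym m≡h+h))
      e = m ∸ suc a
      1+a+e≡m : suc a + e ≡ m
      1+a+e≡m = m+[n∸m]≡n (<⇒≤ k<m)
      a+1+e≡m : a + suc e ≡ m
      a+1+e≡m = trans (+-suc a e) 1+a+e≡m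
      h≤a : h ≤ a
      h≤a = ≤-pred (≰⇒> λ 1+a≤h → 2k≰m (half≤ 1+a≤h))
      1+e≤h : suc e ≤ h
      1+e≤h = +-cancelˡ-≤ h (suc e) h (≤-trans (+-monoˡ-≤ (suc e) h≤a) (≤-reflexive (trans a+1+e≡m m≡h+h)))

  cdist-0+cdist-half : ∀ {h k} → m ≡ suc (h + h) → k < m →
    (k ≤ h → cdist k 0 + cdist k h ≡ h) × (h < k → cdist k 0 + cdist k h ≡ suc h)
  cdist-0+cdist-half {h} {k} m≡1+h+h k<m = before , after
    where
      half≤ : ∀ {x} → x ≤ h → x + x ≤ m
      half≤ x≤h = ≤-trans (+-mono-≤ x≤h x≤h) (≤-trans (n≤1+n (h + h)) (≤-reflexive (sym m≡1+h+h)))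

      before : k ≤ h → cdist k 0 + cdist k h ≡ h
      before k≤h =
        let (d , k+d≡h) = m≤n⇒∃[o]m+o≡n k≤h
        in trans (cong₂ _+_ (proj₂ (cdist-short {0} {k} refl (half≤ k≤h)))
                            (proj₁ (cdist-short {k} {h} k+d≡h (half≤ (≤-trans (m≤n+m d k) (≤-reflexive k+d≡h))))))
                 k+d≡h

      after : h < k → cdist k 0 + cdist k h ≡ suc h
      after h<k =
        let (d , h+d≡k) = m≤n⇒∃[o]m+o≡n (<⇒≤ h<k)
            e = m ∸ k
            k+e≡m = m+[n∸m]≡n (<⇒≤ k<m)
            e≤h = +-cancelˡ-≤ (suc h) e h (≤-trans (+-monoˡ-≤ e h<k) (≤-reflexive (trans k+e≡m m≡1+h+h)))
            d≤h = +-cancelˡ-≤ h d h (≤-pred (≤-trans (subst (λ x → suc x ≤ m) (sym h+d≡k) k<m) (≤-reflexive m≡1+h+h)))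
            d+e≡1+h = +-cancelˡ-≡ h (d + e) (suc h) (trans (sym (+-assoc h d e))
                        (trans (cong (_+ e) h+d≡k) (trans k+e≡m (trans m≡1+h+h (sym (+-suc h h))))))
        in trans (cong₂ _+_ (proj₂ (cdist-long {0} {k} refl k+e≡m (half≤ e≤h))) (proj₂ (cdist-short {h} {k} h+d≡k (half≤ d≤h))))
                 (trans (+-comm e d) d+e≡1+h)

  -- On C (2h+1), d(k,0) + d(k,h) is h or h + 1; this rules out both a reflection and a shift by one.
  module _ {h} (m≡1+h+h : m ≡ suc (h + h)) where

    private
      landmark-sum : ℕ → ℕ
      landmark-sum k = cdist k 0 + cdist k h

      side : ∀ {k} → k < m → (k ≤ h × landmark-sum k ≡ h) ⊎ (h < k × landmark-sum k ≡ suc h)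
      side {k} k<m with k ≤? h
      ... | yes k≤h = inj₁ (k≤h , proj₁ (cdist-0+cdist-half m≡1+h+h k<m) k≤h)
      ... | no  k≰h = inj₂ (≰⇒> k≰h , proj₂ (cdist-0+cdist-half m≡1+h+h k<m) (≰⇒> k≰h))

      h≤sum≤1+h : ∀ {k} → k < m → h ≤ landmark-sum k × landmark-sum k ≤ suc h
      h≤sum≤1+h k<m with side k<m
      ... | inj₁ (_ , sum≡h)   = ≤-reflexive (sym sum≡h) , ≤-trans (≤-reflexive sum≡h) (n≤1+n _)
      ... | inj₂ (_ , sum≡1+h) = ≤-trans (n≤1+n _) (≤-reflexive (sym sum≡1+h)) , ≤-reflexive sum≡1+h

    cdist-0-half-injective : ∀ {k k′} → k < m → k′ < m → cdist k 0 ≡ cdist k′ 0 → cdist k h ≡ cdist k′ h → k ≡ k′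
    cdist-0-half-injective {k} {k′} k<m k′<m e₀ eₕ
      with arc-injective (<⇒≤ k<m) (<⇒≤ k′<m) (trans (sym (cdist-zero k)) (trans e₀ (cdist-zero k′)))
    ... | inj₁ k≡k′ = k≡k′
    ... | inj₂ k+k′≡m with side k<m | side k′<m
    ...   | inj₁ (k≤h , _) | inj₁ (k′≤h , _) =
      ⊥-elim (<-irrefl k+k′≡m (≤-<-trans (+-mono-≤ k≤h k′≤h) (subst (h + h <_) (sym m≡1+h+h) (n<1+n _))))
    ...   | inj₂ (h<k , _) | inj₂ (h<k′ , _) =
      ⊥-elim (<⇒≱ (subst (_< suc h + suc h) (sym m≡1+h+h) (s≤s (subst (h + h <_) (sym (+-suc h h)) (n<1+n _))))
                  (subst (suc h + suc h ≤_) k+k′≡m (+-mono-≤ h<k h<k′)))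
    ...   | inj₁ (_ , sum≡h) | inj₂ (_ , sum′≡1+h) = ⊥-elim (1+n≢n (trans (sym sum′≡1+h) (trans (sym (cong₂ _+_ e₀ eₕ)) sum≡h)))
    ...   | inj₂ (_ , sum≡1+h) | inj₁ (_ , sum′≡h) = ⊥-elim (1+n≢n (trans (sym sum≡1+h) (trans (cong₂ _+_ e₀ eₕ) sum′≡h)))

    cdist-0-half-unshifted : ∀ {k k′} → k < m → k′ < m → cdist k 0 ≡ suc (cdist k′ 0) → cdist k h ≡ suc (cdist k′ h) → ⊥
    cdist-0-half-unshifted {k} {k′} k<m k′<m e₀ eₕ = <⇒≱ (begin-strict
      suc h                  ≤⟨ s≤s (proj₁ (h≤sum≤1+h k′<m)) ⟩
      suc (landmark-sum k′)  <⟨ n<1+n _ ⟩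
      suc (suc (landmark-sum k′)) ≡⟨ sym (trans (cong₂ _+_ e₀ eₕ) (cong suc (+-suc (cdist k′ 0) (cdist k′ h)))) ⟩
      landmark-sum k         ∎) (proj₂ (h≤sum≤1+h k<m))
      where open ≤-Reasoning

-- The cycle C m

module CycleGraph (m₀ : ℕ) where

  m : ℕ
  m = suc m₀

  open CycleArithmetic m public

  C-sym : ∀ {x y : Fin m} → Adj (C m) x y → Adj (C m) y x
  C-sym (inj₁ e) = inj₂ e
  C-sym (inj₂ e) = inj₁ e

  ascend : ∀ d (i j : Fin m) → toℕ i + d ≡ toℕ j → Walk (C m) i j d
  ascend zero    i j i+0≡j = subst (λ x → Walk (C m) i x 0) (toℕ-injective (trans (sym (+-identityʳ _)) i+0≡j)) here
  ascend (suc d) i j i+1+d≡j = step (inj₁ (inj₁ (toℕ-fromℕ< i+1<m))) (ascend d (fromℕ< i+1<m) j i+1+d≡j′)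
    where
      i+1<m : suc (toℕ i) < m
      i+1<m = ≤-<-trans (≤-trans (s≤s (m≤m+n (toℕ i) d)) (≤-reflexive (trans (sym (+-suc (toℕ i) d)) i+1+d≡j))) (toℕ<n j)
      i+1+d≡j′ : toℕ (fromℕ< i+1<m) + d ≡ toℕ j
      i+1+d≡j′ = trans (cong (_+ d) (toℕ-fromℕ< i+1<m)) (trans (sym (+-suc (toℕ i) d)) i+1+d≡j)

  last : Fin m
  last = fromℕ m₀

  last-adj-zero : Adj (C m) last Fin.zero
  last-adj-zero = inj₁ (inj₂ (cong suc (toℕ-fromℕ m₀) , refl))

  private
    around : ∀ d e k → d + (e + suc k) ≡ suc ((k + d) + e)
    around = solve-∀

  walk-≤ : (k p : Fin m) → toℕ k ≤ toℕ p → Walk (C m) k p (cdist (toℕ k) (toℕ p))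
  walk-≤ k p k≤p with m≤n⇒∃[o]m+o≡n k≤p
  ... | d , k+d≡p with ⊓-sel d (m ∸ d)
  ...   | inj₁ arc≡d   = subst (Walk (C m) k p) (sym (trans (cong arc (m+o≡n⇒∣m-n∣≡o k+d≡p)) arc≡d)) (ascend d k p k+d≡p)
  ...   | inj₂ arc≡m∸d = subst (Walk (C m) k p) (sym (trans (cong arc (m+o≡n⇒∣m-n∣≡o k+d≡p)) (trans arc≡m∸d m∸d≡)))
                          (Walk-reverse C-sym p→k)
    where
      e = m₀ ∸ toℕ p
      p+e≡m₀ : toℕ p + e ≡ m₀
      p+e≡m₀ = m+[n∸m]≡n (≤-pred (toℕ<n p))
      p→k : Walk (C m) p k (e + suc (toℕ k))
      p→k = Walk-++ (ascend e p last (trans p+e≡m₀ (sym (toℕ-fromℕ m₀)))) (step last-adj-zero (ascend (toℕ k) Fin.zero k refl))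
      m∸d≡ : m ∸ d ≡ e + suc (toℕ k)
      m∸d≡ = trans (cong (_∸ d) (sym (trans (around d e (toℕ k)) (cong suc (trans (cong (_+ e) k+d≡p) p+e≡m₀)))))
                   (m+n∸m≡n d (e + suc (toℕ k)))

  walk : (k p : Fin m) → Walk (C m) k p (cdist (toℕ k) (toℕ p))
  walk k p with ≤-total (toℕ k) (toℕ p)
  ... | inj₁ k≤p = walk-≤ k p k≤p
  ... | inj₂ p≤k = subst (Walk (C m) k p) (cdist-comm (toℕ p) (toℕ k)) (Walk-reverse C-sym (walk-≤ p k p≤k))

  cdist-step : ∀ {k l : Fin m} → Adj (C m) k l → ∀ p → cdist (toℕ k) (toℕ p) ≤ suc (cdist (toℕ l) (toℕ p))
  cdist-step {k} {l} (inj₁ (inj₁ l≡1+k)) p = subst (λ x → cdist (toℕ k) (toℕ p) ≤ suc (cdist x (toℕ p))) (sym l≡1+k)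
    (proj₂ (cdist-suc (toℕ k) (toℕ p) (subst (_< m) l≡1+k (toℕ<n l)) (toℕ<n p)))
  cdist-step {k} {l} (inj₁ (inj₂ (1+k≡m , l≡0))) p = subst (λ x → cdist (toℕ k) (toℕ p) ≤ suc (cdist x (toℕ p))) (sym l≡0)
    (proj₁ (cdist-wrap (toℕ k) (toℕ p) 1+k≡m (toℕ<n p)))
  cdist-step {k} {l} (inj₂ (inj₁ k≡1+l)) p = subst (λ x → cdist x (toℕ p) ≤ suc (cdist (toℕ l) (toℕ p))) (sym k≡1+l)
    (proj₁ (cdist-suc (toℕ l) (toℕ p) (subst (_< m) k≡1+l (toℕ<n k)) (toℕ<n p)))
  cdist-step {k} {l} (inj₂ (inj₂ (1+l≡m , k≡0))) p = subst (λ x → cdist x (toℕ p) ≤ suc (cdist (toℕ l) (toℕ p))) (sym k≡0)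
    (proj₂ (cdist-wrap (toℕ l) (toℕ p) 1+l≡m (toℕ<n p)))

  distance-C : DistanceFormula (C m)
  distance-C = record
    { δ      = λ k p → cdist (toℕ k) (toℕ p)
    ; δ-walk = walk
    ; δ-self = λ k → cdist-self (toℕ k)
    ; δ-step = cdist-step
    }

  open DistanceFormulaProperties distance-C public using ()
    renaming (δ≡0⇒≡ to cdist≡0⇒≡; δ≡1⇒adjacent to cdist≡1⇒adjacent; δ-adjacent to cdist-adjacent; geodesic-step to cdist-geodesic-step)

  point-at : (p : Fin m) → ∀ {t} → t < m → Σ (Fin m) λ q → Offset (toℕ p) t (toℕ q)
  point-at p t<m with offset-target (toℕ<n p) t<m
  ... | k , k<m , o = fromℕ< k<m , subst (Offset (toℕ p) _) (sym (toℕ-fromℕ< k<m)) o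

  offset-of : (p q : Fin m) → Σ ℕ λ t → t < m × Offset (toℕ p) t (toℕ q) × (t ≡ 0 → p ≡ q)
  offset-of p q with offset-source (toℕ<n p) (toℕ<n q)
  ... | t , t<m , o , t≡0⇒ = t , t<m , o , λ t≡0 → sym (toℕ-injective (t≡0⇒ t≡0))

  cdist-offsets : ∀ {P a b} {k l : Fin m} → a < m → b < m →
    Offset P a (toℕ k) → Offset P b (toℕ l) → cdist (toℕ k) (toℕ l) ≡ cdist a b
  cdist-offsets a<m b<m = cdist-offset a<m b<m (toℕ<n _) (toℕ<n _)

  cdist-offset-from : ∀ {a} {k l : Fin m} → a < m → Offset (toℕ l) a (toℕ k) → cdist (toℕ k) (toℕ l) ≡ arc a
  cdist-offset-from {a} {l = l} a<m o = trans (cdist-offsets a<m (s≤s z≤n) o (offset-zero (toℕ l))) (cdist-zero a)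

  neighbours : 2 < m → (p : Fin m) →
    ∃₂ λ p⁺ p⁻ → p⁺ ≢ p⁻ × cdist (toℕ p⁺) (toℕ p) ≡ 1 × cdist (toℕ p⁻) (toℕ p) ≡ 1
  neighbours 2<m p =
    let (p⁺ , o⁺) = point-at p 1<m
        (p⁻ , o⁻) = point-at p {m₀} ≤-refl
    in p⁺ , p⁻ ,
       (λ p⁺≡p⁻ → <⇒≢ (≤-pred 2<m)
         (offset-injective 1<m ≤-refl o⁺ (subst (λ q → Offset (toℕ p) m₀ (toℕ q)) (sym p⁺≡p⁻) o⁻))) ,
       trans (cdist-offset-from 1<m o⁺) (arc-short (<⇒≤ 2<m)) ,
       trans (cdist-offset-from ≤-refl o⁻) (arc-long (+-comm m₀ 1) (<⇒≤ 2<m))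
    where
      1<m : 1 < m
      1<m = <-trans (n<1+n 1) 2<m

  module EvenCycle {h} (m≡h+h : m ≡ h + h) where

    h<m : h < m
    h<m = subst (h <_) (sym m≡h+h) (m<m+n h (n≢0⇒n>0 λ { refl → 1+n≢0 m≡h+h }))

    cdist-≤-half : ∀ k p → cdist k p ≤ h
    cdist-≤-half k p = arc-≤-half m≡h+h ∣ k - p ∣

    antipode : (p : Fin m) → Σ (Fin m) λ q → cdist (toℕ q) (toℕ p) ≡ h
    antipode p =
      let (q , o) = point-at p h<m
      in q , trans (cdist-offset-from h<m o) (arc-short (≤-reflexive (sym m≡h+h)))

    antipode-unique : ∀ {q q′ p : Fin m} → cdist (toℕ q) (toℕ p) ≡ h → cdist (toℕ q′) (toℕ p) ≡ h → q ≡ q′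
    antipode-unique {q} {q′} {p} qp≡h q′p≡h =
      let (t , t<m , o , _) = offset-of p q
          (t′ , t′<m , o′ , _) = offset-of p q′
          t≡t′ = trans (offset≡h t<m (trans (sym (cdist-offset-from t<m o)) qp≡h))
                       (sym (offset≡h t′<m (trans (sym (cdist-offset-from t′<m o′)) q′p≡h)))
      in toℕ-injective (offset-functional {toℕ p} {t} (toℕ<n q) (toℕ<n q′) o (subst (λ s → Offset (toℕ p) s (toℕ q′)) (sym t≡t′) o′))
      where
        offset≡h : ∀ {t} → t < m → arc t ≡ h → t ≡ h
        offset≡h {t} t<m arc-t≡h
          with arc-injective (<⇒≤ t<m) (<⇒≤ h<m) (trans arc-t≡h (sym (arc-short (≤-reflexive (sym m≡h+h)))))
        ... | inj₁ t≡h   = t≡h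
        ... | inj₂ t+h≡m = +-cancelʳ-≡ h t h (trans t+h≡m m≡h+h)

    antipode-neighbour : ∀ {q w p : Fin m} → cdist (toℕ q) (toℕ p) ≡ h → Adj (C m) q w → w ≢ q →
      suc (cdist (toℕ w) (toℕ p)) ≡ h
    antipode-neighbour {q} {w} {p} qp≡h q~w w≢q = ≤-antisym
      (≤∧≢⇒< (cdist-≤-half (toℕ w) (toℕ p)) (λ wp≡h → w≢q (antipode-unique wp≡h qp≡h)))
      (subst (_≤ suc (cdist (toℕ w) (toℕ p))) qp≡h (cdist-step q~w p))

  module OddCycle {h₀} (m≡1+h+h : m ≡ suc (suc h₀ + suc h₀)) where

    h : ℕ
    h = suc h₀

    private
      half≤ : ∀ {x} → x ≤ h → x + x ≤ m
      half≤ x≤h = ≤-trans (+-mono-≤ x≤h x≤h) (≤-trans (n≤1+n (h + h)) (≤-reflexive (sym m≡1+h+h)))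

      h<m : h < m
      h<m = subst (h <_) (sym m≡1+h+h) (s≤s (m≤m+n h h))

      1+h<m : suc h < m
      1+h<m = subst (suc h <_) (sym m≡1+h+h) (s≤s (s≤s (m≤n+m h h₀)))

      m∸h≡1+h : m ∸ h ≡ suc h
      m∸h≡1+h = trans (cong (_∸ h) m≡1+h+h) (m+n∸n≡m (suc h) h)

      m∸1+h≡h : m ∸ suc h ≡ h
      m∸1+h≡h = trans (cong (_∸ suc h) m≡1+h+h) (m+n∸m≡n (suc h) h)

    Near Far : Fin m → Fin m → Set
    Near p q = ∃ λ t → Offset (toℕ p) t (toℕ q) × 1 ≤ t × t ≤ h
    Far  p q = ∃ λ t → Offset (toℕ p) t (toℕ q) × h < t × t < m

    cdist-near-side : ∀ {t} → 1 ≤ t → t ≤ h → cdist (suc h) t ≡ suc (cdist h t)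
    cdist-near-side {t} 1≤t t≤h =
      let (d , t+d≡h) = m≤n⇒∃[o]m+o≡n t≤h
          1+d≤h = ≤-trans (+-monoˡ-≤ d 1≤t) (≤-reflexive t+d≡h)
      in trans (proj₂ (cdist-short (trans (+-suc t d) (cong suc t+d≡h)) (half≤ 1+d≤h)))
               (cong suc (sym (proj₂ (cdist-short t+d≡h (half≤ (≤-trans (n≤1+n d) 1+d≤h))))))

    cdist-far-side : ∀ {t} → h < t → t < m → cdist h t ≡ suc (cdist (suc h) t)
    cdist-far-side {t} h<t t<m =
      let (d , 1+h+d≡t) = m≤n⇒∃[o]m+o≡n h<t
          1+d≤h = +-cancelˡ-≤ h (suc d) h (≤-pred (begin
            suc (h + suc d)  ≡⟨ cong suc (trans (+-suc h d) 1+h+d≡t) ⟩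
            suc t            ≤⟨ t<m ⟩
            m                ≡⟨ m≡1+h+h ⟩
            suc (h + h)      ∎))
      in trans (proj₁ (cdist-short {h} (trans (+-suc h d) 1+h+d≡t) (half≤ 1+d≤h)))
               (cong suc (sym (proj₁ (cdist-short 1+h+d≡t (half≤ (≤-trans (n≤1+n d) 1+d≤h))))))
      where open ≤-Reasoning

    opposite-edge : (p : Fin m) → ∃₂ λ x y →
        cdist (toℕ x) (toℕ p) ≡ h × cdist (toℕ y) (toℕ p) ≡ h
      × (∀ {q} → Near p q → cdist (toℕ y) (toℕ q) ≡ suc (cdist (toℕ x) (toℕ q)))
      × (∀ {q} → Far p q → cdist (toℕ x) (toℕ q) ≡ suc (cdist (toℕ y) (toℕ q)))
    opposite-edge p =
      let (x , oₓ) = point-at p h<m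
          (y , oᵧ) = point-at p 1+h<m
      in x , y ,
         trans (cdist-offset-from h<m oₓ) (arc-short (half≤ ≤-refl)) ,
         trans (cdist-offset-from 1+h<m oᵧ) (arc-long (sym m≡1+h+h) (half≤ ≤-refl)) ,
         (λ (t , o , 1≤t , t≤h) → let t<m = ≤-<-trans t≤h h<m in
           trans (cdist-offsets 1+h<m t<m oᵧ o)
                 (trans (cdist-near-side 1≤t t≤h) (cong suc (sym (cdist-offsets h<m t<m oₓ o))))) ,
         (λ (t , o , h<t , t<m) →
           trans (cdist-offsets h<m t<m oₓ o)
                 (trans (cdist-far-side h<t t<m) (cong suc (sym (cdist-offsets 1+h<m t<m oᵧ o)))))

    Straddles : Fin m → Fin m → Fin m → Set
    Straddles p q r = (Near p q × Far p r) ⊎ (Near p r × Far p q)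

    near⊎far : ∀ {p q} → p ≢ q → Near p q ⊎ Far p q
    near⊎far {p} {q} p≢q with offset-of p q
    ... | zero  , _   , _ , t≡0⇒ = ⊥-elim (p≢q (t≡0⇒ refl))
    ... | suc t , t<m , o , _ with suc t ≤? h
    ...   | yes 1+t≤h = inj₁ (suc t , o , s≤s z≤n , 1+t≤h)
    ...   | no  1+t≰h = inj₂ (suc t , o , ≰⇒> 1+t≰h , t<m)

    private
      both-near : ∀ {i j l : Fin m} {s t} → Offset (toℕ i) s (toℕ j) → Offset (toℕ i) t (toℕ l) →
        1 ≤ s → s < t → t ≤ h → Near j l × Far j i
      both-near {i} {j} {l} {s} {t} oᵢⱼ oᵢₗ 1≤s s<t t≤h =
        (t ∸ s , offset-+-wrap (toℕ<n l) [m∸s]+t≡[t∸s]+m oⱼᵢ oᵢₗ , m<n⇒0<n∸m s<t , ≤-trans (m∸n≤m t s) t≤h) ,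
        (m ∸ s , oⱼᵢ , h<m∸s , ∸-monoʳ-< {m} {s} {0} 1≤s (<⇒≤ s<m))
        where
          open ≡-Reasoning
          s<m = <-trans s<t (≤-<-trans t≤h h<m)
          oⱼᵢ = offset-reverse (<⇒≤ s<m) oᵢⱼ
          h<m∸s : h < m ∸ s
          h<m∸s = ≤-trans (≤-reflexive (sym m∸h≡1+h)) (∸-monoʳ-≤ m (≤-trans (<⇒≤ s<t) t≤h))
          [m∸s]+t≡[t∸s]+m : m ∸ s + t ≡ t ∸ s + m
          [m∸s]+t≡[t∸s]+m = begin
            m ∸ s + t             ≡⟨ cong (m ∸ s +_) (sym (m+[n∸m]≡n (<⇒≤ s<t))) ⟩
            m ∸ s + (s + (t ∸ s)) ≡⟨ sym (+-assoc (m ∸ s) s (t ∸ s)) ⟩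
            m ∸ s + s + (t ∸ s)   ≡⟨ cong (_+ (t ∸ s)) (m∸n+n≡m (<⇒≤ s<m)) ⟩
            m + (t ∸ s)           ≡⟨ +-comm m (t ∸ s) ⟩
            t ∸ s + m             ∎

      both-far : ∀ {i j l : Fin m} {s t} → Offset (toℕ i) s (toℕ j) → Offset (toℕ i) t (toℕ l) →
        h < s → s < t → t < m → Near l i × Far l j
      both-far {i} {j} {l} {s} {t} oᵢⱼ oᵢₗ h<s s<t t<m =
        (m ∸ t , oₗᵢ , m<n⇒0<n∸m t<m , ≤-trans (∸-monoʳ-≤ m (≤-trans h<s (<⇒≤ s<t))) (≤-reflexive m∸1+h≡h)) ,
        (m ∸ t + s , offset-+ (toℕ<n l) [m∸t]+s<m oₗᵢ oᵢⱼ , ≤-trans h<s (m≤n+m s (m ∸ t)) , [m∸t]+s<m)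
        where
          oₗᵢ = offset-reverse (<⇒≤ t<m) oᵢₗ
          [m∸t]+s<m : m ∸ t + s < m
          [m∸t]+s<m = subst (m ∸ t + s <_) (m∸n+n≡m (<⇒≤ t<m)) (+-monoʳ-< (m ∸ t) s<t)

    straddle : ∀ {i j l : Fin m} → i ≢ j → i ≢ l → j ≢ l → Straddles i j l ⊎ Straddles j i l ⊎ Straddles l i j
    straddle {i} {j} {l} i≢j i≢l j≢l with offset-of i j | offset-of i l
    ... | s , s<m , oᵢⱼ , s≡0⇒ | t , t<m , oᵢₗ , t≡0⇒ = by-offsets (<-cmp s t) (s ≤? h) (t ≤? h)
      where
        1≤s = n≢0⇒n>0 (i≢j ∘ s≡0⇒)
        1≤t = n≢0⇒n>0 (i≢l ∘ t≡0⇒)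

        by-offsets : Tri (s < t) (s ≡ t) (t < s) → Dec (s ≤ h) → Dec (t ≤ h) →
          Straddles i j l ⊎ Straddles j i l ⊎ Straddles l i j
        by-offsets (tri≈ _ refl _) _ _ = ⊥-elim (j≢l (toℕ-injective (offset-functional {toℕ i} {s} (toℕ<n j) (toℕ<n l) oᵢⱼ oᵢₗ)))
        by-offsets _ (yes s≤h) (no t≰h) = inj₁ (inj₁ ((s , oᵢⱼ , 1≤s , s≤h) , (t , oᵢₗ , ≰⇒> t≰h , t<m)))
        by-offsets _ (no s≰h) (yes t≤h) = inj₁ (inj₂ ((t , oᵢₗ , 1≤t , t≤h) , (s , oᵢⱼ , ≰⇒> s≰h , s<m)))
        by-offsets (tri< s<t _ _) (yes _) (yes t≤h) = inj₂ (inj₁ (inj₂ (both-near oᵢⱼ oᵢₗ 1≤s s<t t≤h)))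
        by-offsets (tri> _ _ t<s) (yes s≤h) (yes _) = inj₂ (inj₂ (inj₂ (both-near oᵢₗ oᵢⱼ 1≤t t<s s≤h)))
        by-offsets (tri< s<t _ _) (no s≰h) (no _) = inj₂ (inj₂ (inj₁ (both-far oᵢⱼ oᵢₗ (≰⇒> s≰h) s<t t<m)))
        by-offsets (tri> _ _ t<s) (no _) (no t≰h) = inj₂ (inj₁ (inj₁ (both-far oᵢₗ oᵢⱼ (≰⇒> t≰h) t<s s<m)))

-- Twins and landmarks in K n □ C m

missing : ∀ {n} (L : List (Fin n)) → length L < n → ∃ λ a → a ∉ L
missing {n} L |L|<n = ¬∀⟶∃¬ n (_∈ L) (_∈? L) every-a∈L
  where
    open import Data.List.Membership.DecPropositional (Fin._≟_ {n}) using (_∈?_)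
    every-a∈L : ¬ (∀ a → a ∈ L)
    every-a∈L a∈L with pigeonhole |L|<n (λ a → Any.index (a∈L a))
    ... | i , j , i<j , same-index = Finₚ.<⇒≢ i<j
      (trans (lookup-index (a∈L i)) (trans (cong (List.lookup L) same-index) (sym (lookup-index (a∈L j)))))

missing₂ : ∀ {n} (L : List (Fin n)) → suc (length L) < n → ∃₂ λ a a′ → a ≢ a′ × a ∉ L × a′ ∉ L
missing₂ L 1+|L|<n =
  let (a , a∉L) = missing L (<-trans (n<1+n _) 1+|L|<n)
      (a′ , a′∉a∷L) = missing (a ∷ L) 1+|L|<n
  in a , a′ , (λ a≡a′ → a′∉a∷L (here (sym a≡a′))) , a∉L , a′∉a∷L ∘ there

module K□C (n m′ : ℕ) where

  open CycleGraph (suc (suc m′)) public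

  G : Graph
  G = K n □ C m

  Vertex : Set
  Vertex = Fin n × Fin m

  distance-K□C : DistanceFormula G
  distance-K□C = distance-K□ n distance-C

  open DistanceFormula distance-K□C public using (δ)
  open DistanceFormulaProperties distance-K□C public

  2<m : 2 < m
  2<m = s≤s (s≤s (s≤s z≤n))

  pos₀ pos₁ : Fin m
  pos₀ = Fin.zero
  pos₁ = Fin.suc Fin.zero

  layer≢ : ∀ {a b : Fin n} {k l : Fin m} → a ≢ b → (a , k) ≢ (b , l)
  layer≢ a≢b = a≢b ∘ cong proj₁

  twins-outside-layers : ∀ {S} (L : List (Fin n)) → All (λ x → proj₁ x ∈ L) S → suc (length L) < n → Twins S
  twins-outside-layers L in-L 1+|L|<n with missing₂ L 1+|L|<n
  ... | a , a′ , a≢a′ , a∉L , a′∉L = (a , pos₀) , (a′ , pos₀) , layer≢ a≢a′ , equidistant (All.map same-distance in-L)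
    where
      same-distance : ∀ {x} → proj₁ x ∈ L → δ (a , pos₀) x ≡ δ (a′ , pos₀) x
      same-distance {b , _} b∈L = cong (_+ _)
        (trans ([≢]-≢ {a = a} {b} λ { refl → a∉L b∈L }) (sym ([≢]-≢ {a = a′} {b} λ { refl → a′∉L b∈L })))

  ¬resolving-short : ∀ S → suc (length S) < n → ¬ IsResolving G S
  ¬resolving-short S 1+|S|<n = twins⇒¬resolving (twins-outside-layers (List.map proj₁ S)
    (All.tabulate (∈-map⁺ proj₁)) (subst (λ l → suc l < n) (sym (length-map proj₁ S)) 1+|S|<n))

  twins-one-position : ∀ {S} (a : Fin n) (p : Fin m) → All (λ x → proj₂ x ≡ p) S → Twins S
  twins-one-position a p at-p with neighbours 2<m p
  ... | p⁺ , p⁻ , p⁺≢p⁻ , p⁺p≡1 , p⁻p≡1 = (a , p⁺) , (a , p⁻) , p⁺≢p⁻ ∘ cong proj₂ , equidistant (All.map same-distance at-p)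
    where
      same-distance : ∀ {x} → proj₂ x ≡ p → δ (a , p⁺) x ≡ δ (a , p⁻) x
      same-distance {b , _} refl = cong ([ a ≢ b ] +_) (trans p⁺p≡1 (sym p⁻p≡1))

  ¬resolving-≤1 : ∀ S → length S < 2 → Fin n → ¬ IsResolving G S
  ¬resolving-≤1 []          _ a = twins⇒¬resolving ((a , pos₀) , (a , pos₁) , (λ ()) , equidistant [])
  ¬resolving-≤1 (x ∷ [])    _ a = twins⇒¬resolving (twins-one-position a (proj₂ x) (refl ∷ []))
  ¬resolving-≤1 (_ ∷ _ ∷ _) (s≤s (s≤s ()))

  twins-across-layers : ∀ {a b} → a ≢ b → (i j : Fin m) → Twins ((a , i) ∷ (b , j) ∷ [])
  twins-across-layers {a} {b} a≢b i j with j Fin.≟ i | cdist (toℕ j) (toℕ i) in ji≡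
  ... | yes refl | _ = twins-one-position a i (refl ∷ refl ∷ [])
  ... | no  j≢i | zero  = ⊥-elim (j≢i (cdist≡0⇒≡ ji≡))
  ... | no  _   | suc k with cdist-geodesic-step ji≡
  ...   | j′ , j~j′ , j′i≡k = (a , j) , (b , j′) , layer≢ a≢b , equidistant (at-i ∷ at-j ∷ [])
    where
      j′≢j : j′ ≢ j
      j′≢j refl = 1+n≢n (trans (sym ji≡) j′i≡k)

      at-i : δ (a , j) (a , i) ≡ δ (b , j′) (a , i)
      at-i = trans (cong₂ _+_ ([≢]-refl a) ji≡) (cong₂ _+_ (sym ([≢]-≢ {a = b} {a} (≢-sym a≢b))) (sym j′i≡k))

      at-j : δ (a , j) (b , j) ≡ δ (b , j′) (b , j)
      at-j = trans (cong₂ _+_ ([≢]-≢ {a = a} {b} a≢b) (cdist-self (toℕ j)))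
        (sym (cong₂ _+_ ([≢]-refl b) (≤-antisym (cdist-adjacent (C-sym j~j′)) (n≢0⇒n>0 (j′≢j ∘ cdist≡0⇒≡)))))

  module _ {h} (m≡h+h : m ≡ h + h) where
    open EvenCycle {h} m≡h+h

    twins-antipodal : ∀ {a} {i A : Fin m} → cdist (toℕ A) (toℕ i) ≡ h → Twins ((a , i) ∷ (a , A) ∷ [])
    twins-antipodal {a} {i} {A} Ai≡h with neighbours 2<m i
    ... | p⁺ , p⁻ , p⁺≢p⁻ , p⁺i≡1 , p⁻i≡1 = (a , p⁺) , (a , p⁻) , p⁺≢p⁻ ∘ cong proj₂ , equidistant (
      cong ([ a ≢ a ] +_) (trans p⁺i≡1 (sym p⁻i≡1)) ∷
      cong ([ a ≢ a ] +_) (suc-injective (trans (near-A {p⁺} p⁺i≡1) (sym (near-A {p⁻} p⁻i≡1)))) ∷ [])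
      where
        near-A : ∀ {q} → cdist (toℕ q) (toℕ i) ≡ 1 → suc (cdist (toℕ q) (toℕ A)) ≡ h
        near-A {q} qi≡1 = antipode-neighbour {i} {q} {A} (trans (cdist-comm (toℕ i) (toℕ A)) Ai≡h)
          (cdist≡1⇒adjacent (trans (cdist-comm (toℕ i) (toℕ q)) qi≡1)) λ { refl → 0≢1+n (trans (sym (cdist-self (toℕ i))) qi≡1) }

    twins-off-antipodal : ∀ {a a′} {i j A : Fin m} → a ≢ a′ → cdist (toℕ A) (toℕ i) ≡ h → j ≢ A →
      Twins ((a , i) ∷ (a , j) ∷ [])
    twins-off-antipodal {a} {a′} {i} {j} {A} a≢a′ Ai≡h j≢A with cdist (toℕ A) (toℕ j) in Aj≡
    ... | zero  = ⊥-elim (j≢A (sym (cdist≡0⇒≡ Aj≡)))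
    ... | suc k with cdist-geodesic-step Aj≡
    ...   | w , A~w , wj≡k = (a , A) , (a′ , w) , layer≢ a≢a′ , equidistant (
      trans (cong₂ _+_ ([≢]-refl a) Ai≡h) (sym (trans (cong (_+ _) a′≢a) (antipode-neighbour {A} {w} {i} Ai≡h A~w w≢A))) ∷
      trans (cong₂ _+_ ([≢]-refl a) Aj≡) (sym (trans (cong (_+ _) a′≢a) (cong suc wj≡k))) ∷ [])
      where
        a′≢a : [ a′ ≢ a ] ≡ 1
        a′≢a = [≢]-≢ {a = a′} {a} (≢-sym a≢a′)
        w≢A : w ≢ A
        w≢A refl = 1+n≢n (trans (sym Aj≡) wj≡k)

    twins-same-layer-even : ∀ {a a′} → a ≢ a′ → (i j : Fin m) → Twins ((a , i) ∷ (a , j) ∷ [])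
    twins-same-layer-even a≢a′ i j with antipode i
    ... | A , Ai≡h with j Fin.≟ A
    ...   | yes refl = twins-antipodal Ai≡h
    ...   | no  j≢A  = twins-off-antipodal a≢a′ Ai≡h j≢A

  module _ {h₀} (m≡1+h+h : m ≡ suc (suc h₀ + suc h₀)) where
    open OddCycle {h₀} m≡1+h+h

    opposite-twins : (p : Fin m) → ∀ {a b} → a ≢ b → ∃₂ λ U W → U ≢ W
      × (∀ {q} → Near p q → δ U (a , q) ≡ δ W (a , q))
      × (∀ {q} → Far p q → δ U (b , q) ≡ δ W (b , q))
      × (∀ {c} → c ≢ a → c ≢ b → δ U (c , p) ≡ δ W (c , p))
    opposite-twins p {a} {b} a≢b with opposite-edge p
    ... | x , y , xp≡h , yp≡h , near , far = (a , y) , (b , x) , layer≢ a≢b ,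
      (λ near-q → trans (cong₂ _+_ ([≢]-refl a) (near near-q)) (cong (_+ _) (sym ([≢]-≢ {a = b} {a} (≢-sym a≢b))))) ,
      (λ far-q → trans (cong (_+ _) ([≢]-≢ {a = a} {b} a≢b)) (sym (cong₂ _+_ ([≢]-refl b) (far far-q)))) ,
      (λ {c} c≢a c≢b → cong₂ _+_ (trans ([≢]-≢ {a = a} {c} (≢-sym c≢a)) (sym ([≢]-≢ {a = b} {c} (≢-sym c≢b))))
                                 (trans yp≡h (sym xp≡h)))

    twins-straddle : ∀ {a b c} {p q r : Fin m} → Straddles p q r → a ≢ b → a ≢ c → b ≢ c →
      Twins ((a , p) ∷ (b , q) ∷ (c , r) ∷ [])
    twins-straddle {p = p} (inj₁ (near-q , far-r)) a≢b a≢c b≢c with opposite-twins p b≢c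
    ... | U , W , U≢W , near , far , pivot = U , W , U≢W , equidistant (pivot a≢b a≢c ∷ near near-q ∷ far far-r ∷ [])
    twins-straddle {p = p} (inj₂ (near-r , far-q)) a≢b a≢c b≢c with opposite-twins p (≢-sym b≢c)
    ... | U , W , U≢W , near , far , pivot = U , W , U≢W , equidistant (pivot a≢c a≢b ∷ far far-q ∷ near near-r ∷ [])

    twins-shared-position : ∀ {a b c d} {p q : Fin m} → a ≢ b → a ≢ c → b ≢ c → d ≢ a → d ≢ b → d ≢ c → p ≢ q →
      Twins ((a , p) ∷ (b , p) ∷ (c , q) ∷ [])
    twins-shared-position {p = p} a≢b a≢c b≢c d≢a d≢b d≢c p≢q with near⊎far p≢q
    ... | inj₁ near-q with opposite-twins p (≢-sym d≢c)
    ...   | U , W , U≢W , near , _ , pivot =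
      U , W , U≢W , equidistant (pivot a≢c (≢-sym d≢a) ∷ pivot b≢c (≢-sym d≢b) ∷ near near-q ∷ [])
    twins-shared-position {p = p} a≢b a≢c b≢c d≢a d≢b d≢c p≢q | inj₂ far-q with opposite-twins p d≢c
    ...   | U , W , U≢W , _ , far , pivot =
      U , W , U≢W , equidistant (pivot (≢-sym d≢a) a≢c ∷ pivot (≢-sym d≢b) b≢c ∷ far far-q ∷ [])

    twins-three-layers-odd : ∀ {a b c d} → a ≢ b → a ≢ c → b ≢ c → d ≢ a → d ≢ b → d ≢ c →
      (i j l : Fin m) → Twins ((a , i) ∷ (b , j) ∷ (c , l) ∷ [])
    twins-three-layers-odd {a} a≢b a≢c b≢c d≢a d≢b d≢c i j l with i Fin.≟ j | i Fin.≟ l | j Fin.≟ l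
    ... | yes refl | yes refl | _ = twins-one-position a i (refl ∷ refl ∷ refl ∷ [])
    ... | yes refl | no  i≢l  | _ = twins-shared-position a≢b a≢c b≢c d≢a d≢b d≢c i≢l
    ... | no  i≢j  | yes refl | _ = twins-swap₂₃ (twins-shared-position a≢c a≢b (≢-sym b≢c) d≢a d≢c d≢b i≢j)
    ... | no  i≢j  | no  _    | yes refl =
      twins-swap₁₂ (twins-swap₂₃ (twins-shared-position b≢c (≢-sym a≢b) (≢-sym a≢c) d≢b d≢c d≢a (≢-sym i≢j)))
    ... | no  i≢j  | no  i≢l  | no  j≢l with straddle i≢j i≢l j≢l
    ...   | inj₁ around-i        = twins-straddle around-i a≢b a≢c b≢c
    ...   | inj₂ (inj₁ around-j) = twins-swap₁₂ (twins-straddle around-j (≢-sym a≢b) b≢c a≢c)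
    ...   | inj₂ (inj₂ around-l) = twins-swap₂₃ (twins-swap₁₂ (twins-straddle around-l (≢-sym a≢c) (≢-sym b≢c) a≢b))

  resolving-by-layer-and-position : ∀ S (free : Fin n) → (∀ c → c ≢ free → ∃ λ q → (c , q) ∈ S) →
    (∀ {c c′ k k′} → Equidistant (c , k) (c′ , k′) S → k ≡ k′) → IsResolving G S
  resolving-by-layer-and-position S free covered same-position = separating⇒resolving S separating
    where
      landmark-separates : ∀ {c c′ q k} → (c , q) ∈ S → c ≢ c′ → ¬ Equidistant (c , k) (c′ , k) S
      landmark-separates {c} {c′} {q} {k} cq∈S c≢c′ equi = 1+n≢n (sym (begin
        cdist (toℕ k) (toℕ q)                ≡⟨ cong (_+ cdist (toℕ k) (toℕ q)) (sym ([≢]-refl c)) ⟩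
        [ c ≢ c ] + cdist (toℕ k) (toℕ q)    ≡⟨ equidistant-at equi cq∈S ⟩
        [ c′ ≢ c ] + cdist (toℕ k) (toℕ q)   ≡⟨ cong (_+ cdist (toℕ k) (toℕ q)) ([≢]-≢ {a = c′} {c} (≢-sym c≢c′)) ⟩
        suc (cdist (toℕ k) (toℕ q))          ∎))
        where open ≡-Reasoning

      same-layer : ∀ {c c′ k} → Equidistant (c , k) (c′ , k) S → c ≡ c′
      same-layer {c} {c′} equi with c Fin.≟ c′ | c Fin.≟ free
      ... | yes c≡c′ | _         = c≡c′
      ... | no  c≢c′ | no c≢free = ⊥-elim (landmark-separates (proj₂ (covered c c≢free)) c≢c′ equi)
      ... | no  c≢c′ | yes refl  =
        ⊥-elim (landmark-separates (proj₂ (covered c′ (≢-sym c≢c′))) (≢-sym c≢c′) (equidistant-sym equi))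

      separating : ∀ u w → Equidistant u w S → u ≡ w
      separating (c , k) (c′ , k′) equi with same-position {c} {c′} {k} {k′} equi
      ... | refl = cong (_, k) (same-layer equi)

  cdist-from-two-layers : ∀ {S l₁ l₂ p c c′ k k′} → l₁ ≢ l₂ → (l₁ , p) ∈ S → (l₂ , p) ∈ S →
    Equidistant (c , k) (c′ , k′) S → cdist (toℕ k) (toℕ p) ≡ cdist (toℕ k′) (toℕ p)
  cdist-from-two-layers l₁≢l₂ l₁p∈S l₂p∈S equi = [≢]-cancel l₁≢l₂ (equidistant-at equi l₁p∈S) (equidistant-at equi l₂p∈S)

  cdist-from-one-layer : ∀ {S l p q c c′ k k′} → (l , p) ∈ S → (l , q) ∈ S → Equidistant (c , k) (c′ , k′) S →
    cdist (toℕ k) (toℕ p) ≡ cdist (toℕ k′) (toℕ p) → cdist (toℕ k) (toℕ q) ≡ cdist (toℕ k′) (toℕ q)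
  cdist-from-one-layer {l = l} {c = c} {c′} {k} {k′} lp∈S lq∈S equi same-p =
    +-cancelˡ-≡ [ c ≢ l ] _ _ (trans (equidistant-at equi lq∈S) (cong (_+ _) (sym same-indicator)))
    where
      same-indicator : [ c ≢ l ] ≡ [ c′ ≢ l ]
      same-indicator = +-cancelʳ-≡ _ _ _ (trans (equidistant-at equi lp∈S) (cong ([ c′ ≢ l ] +_) (sym same-p)))

  position-from-0-1 : ∀ {k k′ : Fin m} → cdist (toℕ k) 0 ≡ cdist (toℕ k′) 0 → cdist (toℕ k) 1 ≡ cdist (toℕ k′) 1 → k ≡ k′
  position-from-0-1 {k} {k′} e₀ e₁ = toℕ-injective (cdist-0-1-injective (toℕ<n k) (toℕ<n k′) e₀ e₁)

  resolving-with-adjacent-landmarks : ∀ S (free : Fin n) → (∀ c → c ≢ free → ∃ λ q → (c , q) ∈ S) →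
    ∀ {l l′} → l ≢ l′ → (l , pos₀) ∈ S → (l , pos₁) ∈ S → (l′ , pos₀) ∈ S → IsResolving G S
  resolving-with-adjacent-landmarks S free covered l≢l′ l0∈S l1∈S l′0∈S =
    resolving-by-layer-and-position S free covered λ equi →
      let same-0 = cdist-from-two-layers l≢l′ l0∈S l′0∈S equi
      in position-from-0-1 same-0 (cdist-from-one-layer l0∈S l1∈S equi same-0)

-- The metric dimension of K n □ C m

private
  h*2≡h+h : ∀ h → h * 2 ≡ h + h
  h*2≡h+h h = trans (*-comm h 2) (cong (h +_) (+-identityʳ h))

even⇒≡h+h : ∀ m → m % 2 ≡ 0 → m ≡ m / 2 + m / 2
even⇒≡h+h m m%2≡0 = trans (m≡m%n+[m/n]*n m 2) (trans (cong (_+ m / 2 * 2) m%2≡0) (h*2≡h+h (m / 2)))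

odd⇒≡1+h+h : ∀ m → m % 2 ≡ 1 → m ≡ suc (m / 2 + m / 2)
odd⇒≡1+h+h m m%2≡1 = trans (m≡m%n+[m/n]*n m 2) (trans (cong (_+ m / 2 * 2) m%2≡1) (cong suc (h*2≡h+h (m / 2))))

odd-≥3⇒≡1+h+h : ∀ m′ → (3 + m′) % 2 ≡ 1 → ∃ λ h₀ → 3 + m′ ≡ suc (suc h₀ + suc h₀)
odd-≥3⇒≡1+h+h m′ odd with (3 + m′) / 2 | odd⇒≡1+h+h (3 + m′) odd
... | suc h₀ | m≡1+h+h = h₀ , m≡1+h+h

β-K₁□C : ∀ {m} → 3 ≤ m → MetricDim (K 1 □ C m) 2
β-K₁□C {suc (suc (suc m′))} (s≤s (s≤s (s≤s z≤n))) =
  (S , ((λ ()) ∷ []) ∷ [] ∷ [] , refl , resolving) , λ S′ |S′|<2 → ¬resolving-≤1 S′ |S′|<2 Fin.zero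
  where
    open K□C 1 m′
    S : List Vertex
    S = (Fin.zero , pos₀) ∷ (Fin.zero , pos₁) ∷ []
    resolving : IsResolving G S
    resolving = resolving-by-layer-and-position S Fin.zero (λ { Fin.zero 0≢0 → ⊥-elim (0≢0 refl) }) position
      where
        position : ∀ {c c′ k k′} → Equidistant (c , k) (c′ , k′) S → k ≡ k′
        position {Fin.zero} {Fin.zero} equi =
          position-from-0-1 (equidistant-at equi (here refl)) (equidistant-at equi (there (here refl)))

β-K₂□C-odd : ∀ {m} → 3 ≤ m → m % 2 ≡ 1 → MetricDim (K 2 □ C m) 2
β-K₂□C-odd {suc (suc (suc m′))} (s≤s (s≤s (s≤s z≤n))) odd =
  (S , (pos₀≢posₕ ∷ []) ∷ [] ∷ [] , refl , resolving) , λ S′ |S′|<2 → ¬resolving-≤1 S′ |S′|<2 Fin.zero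
  where
    open K□C 2 m′
    h₀ = proj₁ (odd-≥3⇒≡1+h+h m′ odd)
    h = suc h₀
    m≡1+h+h : m ≡ suc (h + h)
    m≡1+h+h = proj₂ (odd-≥3⇒≡1+h+h m′ odd)
    h<m : h < m
    h<m = subst (h <_) (sym m≡1+h+h) (s≤s (m≤m+n h h))
    posₕ : Fin m
    posₕ = fromℕ< h<m

    S : List Vertex
    S = (Fin.zero , pos₀) ∷ (Fin.zero , posₕ) ∷ []

    pos₀≢posₕ : (Fin.zero , pos₀) ≢ (Fin.zero , posₕ)
    pos₀≢posₕ e = 0≢1+n (trans (cong (toℕ ∘ proj₂) e) (toℕ-fromℕ< h<m))

    landmark-distances : ∀ {c c′ k k′} → Equidistant (c , k) (c′ , k′) S →
        [ c ≢ Fin.zero ] + cdist (toℕ k) 0 ≡ [ c′ ≢ Fin.zero ] + cdist (toℕ k′) 0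
      × [ c ≢ Fin.zero ] + cdist (toℕ k) h ≡ [ c′ ≢ Fin.zero ] + cdist (toℕ k′) h
    landmark-distances {c} {c′} {k} {k′} equi = equidistant-at equi (here refl) ,
      subst (λ x → [ c ≢ Fin.zero ] + cdist (toℕ k) x ≡ [ c′ ≢ Fin.zero ] + cdist (toℕ k′) x)
            (toℕ-fromℕ< h<m) (equidistant-at equi (there (here refl)))

    position : ∀ {c c′ k k′} → Equidistant (c , k) (c′ , k′) S → k ≡ k′
    position {c} {c′} {k} {k′} equi with c | c′ | landmark-distances {c} {c′} {k} {k′} equi
    ... | Fin.zero       | Fin.zero       | e₀ , eₕ = toℕ-injective (cdist-0-half-injective m≡1+h+h (toℕ<n k) (toℕ<n k′) e₀ eₕ)
    ... | Fin.suc Fin.zero | Fin.suc Fin.zero | e₀ , eₕ =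
      toℕ-injective (cdist-0-half-injective m≡1+h+h (toℕ<n k) (toℕ<n k′) (suc-injective e₀) (suc-injective eₕ))
    ... | Fin.zero       | Fin.suc Fin.zero | e₀ , eₕ = ⊥-elim (cdist-0-half-unshifted m≡1+h+h (toℕ<n k) (toℕ<n k′) e₀ eₕ)
    ... | Fin.suc Fin.zero | Fin.zero       | e₀ , eₕ = ⊥-elim (cdist-0-half-unshifted m≡1+h+h (toℕ<n k′) (toℕ<n k) (sym e₀) (sym eₕ))

    resolving : IsResolving G S
    resolving = resolving-by-layer-and-position S (Fin.suc Fin.zero)
      (λ { Fin.zero _ → pos₀ , here refl ; (Fin.suc Fin.zero) 1≢1 → ⊥-elim (1≢1 refl) }) position

β-K₂□C-even : ∀ {m} → 3 ≤ m → m % 2 ≡ 0 → MetricDim (K 2 □ C m) 3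
β-K₂□C-even {suc (suc (suc m′))} (s≤s (s≤s (s≤s z≤n))) even =
  (S , ((λ ()) ∷ (λ ()) ∷ []) ∷ ((λ ()) ∷ []) ∷ [] ∷ [] , refl , resolving) , lower
  where
    open K□C 2 m′
    S : List Vertex
    S = (Fin.zero , pos₀) ∷ (Fin.zero , pos₁) ∷ (Fin.suc Fin.zero , pos₀) ∷ []

    resolving : IsResolving G S
    resolving = resolving-with-adjacent-landmarks S (Fin.suc Fin.zero)
      (λ { Fin.zero _ → pos₀ , here refl ; (Fin.suc Fin.zero) 1≢1 → ⊥-elim (1≢1 refl) })
      (λ ()) (here refl) (there (here refl)) (there (there (here refl)))

    other : (a : Fin 2) → ∃ (a ≢_)
    other Fin.zero           = Fin.suc Fin.zero , λ ()
    other (Fin.suc Fin.zero) = Fin.zero , λ ()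

    lower : ∀ S′ → length S′ < 3 → ¬ IsResolving G S′
    lower []       _ = ¬resolving-≤1 [] (s≤s z≤n) Fin.zero
    lower (x ∷ []) _ = ¬resolving-≤1 (x ∷ []) (s≤s (s≤s z≤n)) Fin.zero
    lower ((a , i) ∷ (b , j) ∷ []) _ with a Fin.≟ b
    ... | no  a≢b  = twins⇒¬resolving (twins-across-layers a≢b i j)
    ... | yes refl = twins⇒¬resolving (twins-same-layer-even {m / 2} (even⇒≡h+h m even) (proj₂ (other a)) i j)
    lower (_ ∷ _ ∷ _ ∷ _) (s≤s (s≤s (s≤s ())))

β-K₃□C : ∀ {m} → 3 ≤ m → MetricDim (K 3 □ C m) 3
β-K₃□C {suc (suc (suc m′))} (s≤s (s≤s (s≤s z≤n))) =
  (S , ((λ ()) ∷ (λ ()) ∷ []) ∷ ((λ ()) ∷ []) ∷ [] ∷ [] , refl , resolving) , lower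
  where
    open K□C 3 m′
    S : List Vertex
    S = (Fin.zero , pos₀) ∷ (Fin.zero , pos₁) ∷ (Fin.suc Fin.zero , pos₀) ∷ []

    resolving : IsResolving G S
    resolving = resolving-with-adjacent-landmarks S (Fin.suc (Fin.suc Fin.zero))
      (λ { Fin.zero _ → pos₀ , here refl ; (Fin.suc Fin.zero) _ → pos₀ , there (there (here refl))
         ; (Fin.suc (Fin.suc Fin.zero)) 2≢2 → ⊥-elim (2≢2 refl) })
      (λ ()) (here refl) (there (here refl)) (there (there (here refl)))

    lower : ∀ S′ → length S′ < 3 → ¬ IsResolving G S′
    lower []       _ = ¬resolving-short [] (s≤s (s≤s z≤n))
    lower (x ∷ []) _ = ¬resolving-short (x ∷ []) (s≤s (s≤s (s≤s z≤n)))
    lower ((a , i) ∷ (b , j) ∷ []) _ with a Fin.≟ b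
    ... | no  a≢b  = twins⇒¬resolving (twins-across-layers a≢b i j)
    ... | yes refl = twins⇒¬resolving (twins-outside-layers (a ∷ []) (here refl ∷ here refl ∷ []) (s≤s (s≤s (s≤s z≤n))))
    lower (_ ∷ _ ∷ _ ∷ _) (s≤s (s≤s (s≤s ())))

≤1-+-cancel-±1 : ∀ {A B X Y Y′} → A ≤ 1 → B ≤ 1 → A + Y ≡ B + Y′ →
  Y ≡ suc X ⊎ X ≡ suc Y → Y′ ≡ suc X ⊎ X ≡ suc Y′ → Y ≡ Y′
≤1-+-cancel-±1 {zero}  {zero}  _ _ e _ _ = e
≤1-+-cancel-±1 {suc zero} {suc zero} _ _ e _ _ = suc-injective e
≤1-+-cancel-±1 {zero}  {suc zero} _ _ e Y±1 Y′±1 = ⊥-elim (not-one-apart e Y±1 Y′±1)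
  where
    not-one-apart : ∀ {X Y Y′} → Y ≡ suc Y′ → Y ≡ suc X ⊎ X ≡ suc Y → Y′ ≡ suc X ⊎ X ≡ suc Y′ → ⊥
    not-one-apart e (inj₁ p) (inj₁ q) = 1+n≢n (trans (sym q) (suc-injective (trans (sym e) p)))
    not-one-apart e (inj₁ p) (inj₂ q) = 1+n≢n (trans (sym p) (trans e (sym q)))
    not-one-apart {X} e (inj₂ p) (inj₁ q) = m≢1+n+m X {2} (trans p (trans (cong suc e) (cong (λ z → suc (suc z)) q)))
    not-one-apart e (inj₂ p) (inj₂ q) = 1+n≢n (trans (sym e) (suc-injective (trans (sym p) q)))
≤1-+-cancel-±1 {suc zero} {zero} A≤1 B≤1 e Y±1 Y′±1 = sym (≤1-+-cancel-±1 B≤1 A≤1 (sym e) Y′±1 Y±1)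
≤1-+-cancel-±1 {suc (suc _)} (s≤s ())
≤1-+-cancel-±1 {_} {suc (suc _)} _ (s≤s ())

β-K₄□C-even : ∀ {m} → 3 ≤ m → m % 2 ≡ 0 → MetricDim (K 4 □ C m) 3
β-K₄□C-even {suc (suc (suc m′))} (s≤s (s≤s (s≤s z≤n))) even =
  (S , ((λ ()) ∷ (λ ()) ∷ []) ∷ ((λ ()) ∷ []) ∷ [] ∷ [] , refl , resolving) ,
  λ S′ |S′|<3 → ¬resolving-short S′ (s≤s |S′|<3)
  where
    open K□C 4 m′
    l₀ l₁ l₂ : Fin 4
    l₀ = Fin.zero
    l₁ = Fin.suc Fin.zero
    l₂ = Fin.suc (Fin.suc Fin.zero)

    S : List Vertex
    S = (l₀ , pos₀) ∷ (l₁ , pos₁) ∷ (l₂ , pos₀) ∷ []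

    -- On an even cycle d(k,1) = d(k,0) ± 1, so the landmark at position 1 determines d(k,1) whatever the layers.
    position : ∀ {c c′ k k′} → Equidistant (c , k) (c′ , k′) S → k ≡ k′
    position {c} {c′} {k} {k′} equi = position-from-0-1 same-0
      (≤1-+-cancel-±1 ([≢]≤1 c l₁) ([≢]≤1 c′ l₁) (equidistant-at equi (there (here refl)))
        (cdist-1-parity {m / 2} (even⇒≡h+h m even) 2<m (toℕ<n k))
        (subst (λ x → cdist (toℕ k′) 1 ≡ suc x ⊎ x ≡ suc (cdist (toℕ k′) 1)) (sym same-0)
          (cdist-1-parity {m / 2} (even⇒≡h+h m even) 2<m (toℕ<n k′))))
      where
        same-0 = cdist-from-two-layers {c = c} {c′} {k} {k′} (λ ()) (here refl) (there (there (here refl))) equi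

    resolving : IsResolving G S
    resolving = resolving-by-layer-and-position S (Fin.suc (Fin.suc (Fin.suc Fin.zero)))
      (λ { Fin.zero _ → pos₀ , here refl ; (Fin.suc Fin.zero) _ → pos₁ , there (here refl)
         ; (Fin.suc (Fin.suc Fin.zero)) _ → pos₀ , there (there (here refl))
         ; (Fin.suc (Fin.suc (Fin.suc Fin.zero))) 3≢3 → ⊥-elim (3≢3 refl) })
      position

β-K₄□C-odd : ∀ {m} → 3 ≤ m → m % 2 ≡ 1 → MetricDim (K 4 □ C m) 4
β-K₄□C-odd {suc (suc (suc m′))} (s≤s (s≤s (s≤s z≤n))) odd =
  (S , ((λ ()) ∷ (λ ()) ∷ (λ ()) ∷ []) ∷ ((λ ()) ∷ (λ ()) ∷ []) ∷ ((λ ()) ∷ []) ∷ [] ∷ [] , refl , resolving) , lower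
  where
    open K□C 4 m′
    S : List Vertex
    S = (Fin.zero , pos₀) ∷ (Fin.zero , pos₁) ∷ (Fin.suc Fin.zero , pos₀) ∷ (Fin.suc (Fin.suc Fin.zero) , pos₀) ∷ []

    resolving : IsResolving G S
    resolving = resolving-with-adjacent-landmarks S (Fin.suc (Fin.suc (Fin.suc Fin.zero)))
      (λ { Fin.zero _ → pos₀ , here refl ; (Fin.suc Fin.zero) _ → pos₀ , there (there (here refl))
         ; (Fin.suc (Fin.suc Fin.zero)) _ → pos₀ , there (there (there (here refl)))
         ; (Fin.suc (Fin.suc (Fin.suc Fin.zero))) 3≢3 → ⊥-elim (3≢3 refl) })
      (λ ()) (here refl) (there (here refl)) (there (there (here refl)))

    outside-two-layers : ∀ {S′} (a b : Fin 4) → All (λ x → proj₁ x ∈ a ∷ b ∷ []) S′ → ¬ IsResolving G S′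
    outside-two-layers a b in-ab = twins⇒¬resolving (twins-outside-layers (a ∷ b ∷ []) in-ab (s≤s (s≤s (s≤s (s≤s z≤n)))))

    lower : ∀ S′ → length S′ < 4 → ¬ IsResolving G S′
    lower []           _ = ¬resolving-short [] (s≤s (s≤s z≤n))
    lower (x ∷ [])     _ = ¬resolving-short (x ∷ []) (s≤s (s≤s (s≤s z≤n)))
    lower (x ∷ y ∷ []) _ = ¬resolving-short (x ∷ y ∷ []) (s≤s (s≤s (s≤s (s≤s z≤n))))
    lower ((a , i) ∷ (b , j) ∷ (c , l) ∷ []) _ with a Fin.≟ b | a Fin.≟ c | b Fin.≟ c
    ... | yes refl | _        | _        = outside-two-layers a c (here refl ∷ here refl ∷ there (here refl) ∷ [])
    ... | no  _    | yes refl | _        = outside-two-layers a b (here refl ∷ there (here refl) ∷ here refl ∷ [])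
    ... | no  _    | no  _    | yes refl = outside-two-layers a b (here refl ∷ there (here refl) ∷ there (here refl) ∷ [])
    ... | no  a≢b  | no  a≢c  | no  b≢c with missing (a ∷ b ∷ c ∷ []) (s≤s (s≤s (s≤s (s≤s z≤n))))
    ...   | d , d∉abc = twins⇒¬resolving (twins-three-layers-odd (proj₂ (odd-≥3⇒≡1+h+h m′ odd))
            a≢b a≢c b≢c (d∉abc ∘ here) (d∉abc ∘ there ∘ here) (d∉abc ∘ there ∘ there ∘ here) i j l)
    lower (_ ∷ _ ∷ _ ∷ _ ∷ _) (s≤s (s≤s (s≤s (s≤s ()))))

β-K□C : ∀ {n m} → 5 ≤ n → 3 ≤ m → MetricDim (K n □ C m) (n ∸ 1)
β-K□C {suc n′@(suc (suc (suc (suc _))))} {suc (suc (suc m′))} (s≤s (s≤s (s≤s (s≤s (s≤s z≤n))))) (s≤s (s≤s (s≤s z≤n))) =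
  (S , unique , |S|≡n′ , resolving) , λ S′ |S′|<n′ → ¬resolving-short S′ (s≤s |S′|<n′)
  where
    open K□C (suc n′) m′

    position-of : Fin n′ → Fin m
    position-of Fin.zero                 = pos₁
    position-of (Fin.suc Fin.zero)       = pos₁
    position-of (Fin.suc (Fin.suc _))    = pos₀

    landmark : Fin n′ → Vertex
    landmark c = Fin.inject₁ c , position-of c

    S : List Vertex
    S = List.map landmark (List.allFin n′)

    landmark∈S : ∀ c → landmark c ∈ S
    landmark∈S c = ∈-map⁺ landmark (∈-allFin c)

    unique : Unique S
    unique = Unique.map⁺ (Finₚ.inject₁-injective ∘ cong proj₁) (Unique.allFin⁺ n′)

    |S|≡n′ : length S ≡ n′
    |S|≡n′ = trans (length-map landmark (List.allFin n′)) (length-tabulate id)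

    covered : ∀ c → c ≢ fromℕ n′ → ∃ λ q → (c , q) ∈ S
    covered c c≢last = position-of c₀ , subst (λ x → (x , position-of c₀) ∈ S) (Finₚ.inject₁-lower₁ c n′≢c) (landmark∈S c₀)
      where
        n′≢c : n′ ≢ toℕ c
        n′≢c n′≡c = c≢last (toℕ-injective (trans (sym n′≡c) (sym (toℕ-fromℕ n′))))
        c₀ = Fin.lower₁ c n′≢c

    resolving : IsResolving G S
    resolving = resolving-by-layer-and-position S (fromℕ n′) covered λ {c} {c′} {k} {k′} equi → position-from-0-1
      (cdist-from-two-layers {c = c} {c′} {k} {k′} (λ ()) (landmark∈S (Fin.suc (Fin.suc Fin.zero))) (landmark∈S (Fin.suc (Fin.suc (Fin.suc Fin.zero)))) equi)
      (cdist-from-two-layers {c = c} {c′} {k} {k′} (λ ()) (landmark∈S Fin.zero) (landmark∈S (Fin.suc Fin.zero)) equi)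

theorem8p5 : ∀ (n m : ℕ) → 1 ≤ n → 3 ≤ m →
    (n ≡ 1 → MetricDim (K n □ C m) 2)
    × (n ≡ 2 → m % 2 ≡ 1 → MetricDim (K n □ C m) 2)
    × (n ≡ 2 → m % 2 ≡ 0 → MetricDim (K n □ C m) 3)
    × (n ≡ 3 → MetricDim (K n □ C m) 3)
    × (n ≡ 4 → m % 2 ≡ 0 → MetricDim (K n □ C m) 3)
    × (n ≡ 4 → m % 2 ≡ 1 → MetricDim (K n □ C m) 4)
    × (5 ≤ n → MetricDim (K n □ C m) (n ∸ 1))
theorem8p5 n m _ 3≤m =
    (λ { refl → β-K₁□C 3≤m })
  , (λ { refl odd → β-K₂□C-odd 3≤m odd })
  , (λ { refl even → β-K₂□C-even 3≤m even })
  , (λ { refl → β-K₃□C 3≤m })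
  , (λ { refl even → β-K₄□C-even 3≤m even })
  , (λ { refl odd → β-K₄□C-odd 3≤m odd })
  , (λ 5≤n → β-K□C 5≤n 3≤m)
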